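{- Let $h\geq 3$ and $k\geq 3h+1$ be positive integers. Let $A$ be a finite set of $k$ integers such that $\min(A)=0$, $\gcd(A)=1$, and $|h^{\wedge}A| = hk-h^2+2$. Then $A=[0,k]\setminus\{x\}$ for some $x\in\{1,k-1\}$.
   Context: For a finite set $A$ of integers and a positive integer $h\le |A|$, the restricted $h$-fold sumset $h^{\wedge}A$ is the set of all sums of $h$ distinct elements of $A$. For integers $\alpha\le\beta$, $[\alpha,\beta]=\{x\in\mathbb{Z}:\alpha\le x\le\beta\}$. $\gcd(A)$ denotes the greatest common divisor of the elements of $A$. -}

module Defs where

open import Data.Nat using (ℕ; zero; suc)
open import Data.Nat.GCD using (gcd)
open import Data.Integer using (ℤ; ∣_∣; _+_; +_)
open import Data.List using (List; []; _∷_; length; foldr; map)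
open import Data.List.Membership.Propositional using (_∈_)
open import Data.List.Relation.Binary.Sublist.Propositional using (_⊆_)
open import Data.List.Relation.Unary.Unique.Propositional using (Unique)
open import Data.Product using (Σ; _×_; ∃-syntax)
open import Relation.Binary.PropositionalEquality using (_≡_)
open import Function.Bundles using (_⇔_)

-- A finite set of integers is represented by a duplicate-free list.

gcdSet : List ℤ → ℕ
gcdSet A = foldr (λ a g → gcd ∣ a ∣ g) 0 A

sumℤ : List ℤ → ℤ
sumℤ = foldr _+_ (+ 0)

-- s ∈ h^A : s is a sum of h distinct elements of A
-- (a sublist of length h of the duplicate-free list A, i.e. an h-element subset)
InRestrictedSumset : ℕ → List ℤ → ℤ → Set
InRestrictedSumset h A s = ∃[ B ] (B ⊆ A × length B ≡ h × sumℤ B ≡ s)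

RestrictedSumsetCard : ℕ → List ℤ → ℕ → Set
RestrictedSumsetCard h A n =
  ∃[ L ] (Unique L × length L ≡ n × (∀ s → (s ∈ L) ⇔ InRestrictedSumset h A s))

{-# OPTIONS --safe #-}
module Submission where

-- Enumerate A increasingly as a 0 = 0 < a 1 < … < a (k − 1).  The sums of h consecutive
-- elements, and the sums of h + 1 consecutive elements with one of them left out, form the
-- classical increasing chain of h(k − h) + 1 elements of h^A; since |h^A| = h(k − h) + 2, at
-- most one element of h^A lies off this chain.  Leaving out two of h + 2 consecutive elements
-- gives sums strictly between consecutive chain elements whenever the steps
-- d j = a (j + 1) − a j fail to be monotone in suitable windows, each failure producing a
-- different off-chain sum.  Hence all steps equal some c, except possibly the first or the
-- last, which equals some u ≥ c.  If u > 2c, or c < u < 2c with c ∤ u, two distinct off-chain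
-- sums appear.  Otherwise c ∣ u, so c divides every element and c = 1; and u = 1 is excluded
-- because an arithmetic progression has only h(k − h) + 1 sums.  So u = 2.

open import Defs
open import Data.Bool using (Bool; true; false; if_then_else_)
open import Data.Empty using (⊥-elim)
open import Data.Integer as ℤ using (ℤ; +_; 0ℤ; -_) renaming (_≤_ to _≤ℤ_; _<_ to _<ℤ_; _+_ to _+ℤ_; _-_ to _-ℤ_)
import Data.Integer.Properties as ℤP
open import Data.Integer.Tactic.RingSolver using (solve-∀)
open import Data.List using (List; []; _∷_; _++_; length; map; upTo)
open import Data.List.Properties using (length-++; length-map; length-upTo)
open import Data.List.Membership.Propositional using (_∈_; _∉_)
open import Data.List.Membership.Propositional.Properties using (∈-∃++; ∈-++⁻; ∈-map⁺; ∈-upTo⁺)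
open import Data.List.Relation.Binary.Permutation.Propositional as ↭ using (_↭_; ↭-sym; ↭⇒↭ₛ)
open import Data.List.Relation.Binary.Permutation.Propositional.Properties using (↭-length; ∈-resp-↭)
import Data.List.Relation.Binary.Permutation.Setoid.Properties as ↭ₛ
open import Data.List.Relation.Binary.Sublist.Propositional using (_⊆_; []; _∷_; _∷ʳ_)
open import Data.List.Relation.Binary.Sublist.Propositional.Properties using (length-mono-≤)
open import Data.List.Relation.Unary.All as All using ([]; _∷_)
open import Data.List.Relation.Unary.AllPairs as AllPairs using (AllPairs; []; _∷_)
import Data.List.Relation.Unary.AllPairs.Properties as AllPairsₚ
open import Data.List.Relation.Unary.Any using (here; there)
open import Data.List.Relation.Unary.Linked as Linked using (_∷_)
open import Data.List.Relation.Unary.Sorted.TotalOrder ℤP.≤-totalOrder using (Sorted)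
open import Data.List.Relation.Unary.Unique.Propositional using (Unique)
import Data.List.Sort ℤP.≤-decTotalOrder as Sort
open import Data.Nat using (ℕ; zero; suc; pred; _+_; _*_; _∸_; _≤_; _<_; s≤s; z≤n; _≟_; ≢-nonZero)
import Data.Nat.Properties as ℕP
open import Data.Nat.Divisibility using (_∣_; _∣?_; divides; ∣m∣n⇒∣m+n; ∣m+n∣m⇒∣n; n∣m*n; ∣1⇒≡1)
open import Data.Nat.GCD using (gcd-greatest)
open import Data.Nat.Tactic.RingSolver using () renaming (solve-∀ to solveℕ-∀)
open import Data.Product using (_×_; _,_; proj₁; proj₂; ∃; ∃₂; ∃-syntax)
open import Data.Sum as Sum using (_⊎_; inj₁; inj₂; [_,_]′)
open import Function.Bundles using (_⇔_; Equivalence; mk⇔)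
open import Relation.Binary.Definitions using (tri<; tri≈; tri>)
open import Relation.Binary.PropositionalEquality as ≡ using (_≡_; _≢_; sym; cong; cong₂; subst; subst₂)
open import Relation.Nullary using (¬_; Dec; yes; no)
open import Relation.Nullary.Decidable using (_×-dec_; map′)

[x+y]-y≡x : ∀ x y → (x +ℤ y) -ℤ y ≡ x
[x+y]-y≡x = solve-∀

[x+y]-x≡y : ∀ x y → (x +ℤ y) -ℤ x ≡ y
[x+y]-x≡y = solve-∀

∈-++-skip : ∀ {A : Set} (ys : List A) {x y : A} {zs : List A} → y ∈ ys ++ x ∷ zs → y ≢ x → y ∈ ys ++ zs
∈-++-skip []       (here y≡x) y≢x = ⊥-elim (y≢x y≡x)
∈-++-skip []       (there p)  _   = p
∈-++-skip (_ ∷ ys) (here y≡w) _   = here y≡w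
∈-++-skip (_ ∷ ys) (there p)  y≢x = there (∈-++-skip ys p y≢x)

Unique⇒length≤ : ∀ {A : Set} {xs ys : List A} → Unique xs → (∀ {x} → x ∈ xs → x ∈ ys) → length xs ≤ length ys
Unique⇒length≤ {xs = []} _ _ = z≤n
Unique⇒length≤ {xs = x ∷ xs} (x∉xs ∷ u) xs⊆ys with ∈-∃++ (xs⊆ys (here ≡.refl))
... | ys₁ , ys₂ , ≡.refl = subst (suc (length xs) ≤_) length-insert (s≤s (Unique⇒length≤ u xs⊆ys₁++ys₂))
  where
  xs⊆ys₁++ys₂ : ∀ {y} → y ∈ xs → y ∈ ys₁ ++ ys₂
  xs⊆ys₁++ys₂ p = ∈-++-skip ys₁ (xs⊆ys (there p)) (λ y≡x → All.lookup x∉xs p (sym y≡x))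
  length-insert : suc (length (ys₁ ++ ys₂)) ≡ length (ys₁ ++ x ∷ ys₂)
  length-insert = ≡.trans (cong suc (length-++ ys₁))
                  (≡.trans (sym (ℕP.+-suc (length ys₁) (length ys₂))) (sym (length-++ ys₁)))

↭-lift-⊆ : ∀ {A : Set} {xs ys bs : List A} → xs ↭ ys → bs ⊆ xs → ∃ λ bs′ → bs′ ⊆ ys × bs ↭ bs′
↭-lift-⊆ {bs = bs} ↭.refl s = bs , s , ↭.refl
↭-lift-⊆ (↭.prep x p) (.x ∷ʳ s) with ↭-lift-⊆ p s
... | bs′ , s′ , q = bs′ , x ∷ʳ s′ , q
↭-lift-⊆ (↭.prep x p) (≡.refl ∷ s) with ↭-lift-⊆ p s
... | bs′ , s′ , q = x ∷ bs′ , ≡.refl ∷ s′ , ↭.prep x q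
↭-lift-⊆ (↭.swap x y p) (.x ∷ʳ (.y ∷ʳ s)) with ↭-lift-⊆ p s
... | bs′ , s′ , q = bs′ , y ∷ʳ (x ∷ʳ s′) , q
↭-lift-⊆ (↭.swap x y p) (.x ∷ʳ (≡.refl ∷ s)) with ↭-lift-⊆ p s
... | bs′ , s′ , q = y ∷ bs′ , ≡.refl ∷ (x ∷ʳ s′) , ↭.prep y q
↭-lift-⊆ (↭.swap x y p) (≡.refl ∷ (.y ∷ʳ s)) with ↭-lift-⊆ p s
... | bs′ , s′ , q = x ∷ bs′ , y ∷ʳ (≡.refl ∷ s′) , ↭.prep x q
↭-lift-⊆ (↭.swap x y p) (≡.refl ∷ (≡.refl ∷ s)) with ↭-lift-⊆ p s
... | bs′ , s′ , q = y ∷ x ∷ bs′ , ≡.refl ∷ (≡.refl ∷ s′) , ↭.swap x y q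
↭-lift-⊆ (↭.trans p p′) s with ↭-lift-⊆ p s
... | bs₁ , s₁ , q₁ with ↭-lift-⊆ p′ s₁
...   | bs₂ , s₂ , q₂ = bs₂ , s₂ , ↭.trans q₁ q₂

sumℤ-↭ : ∀ {xs ys : List ℤ} → xs ↭ ys → sumℤ xs ≡ sumℤ ys
sumℤ-↭ p = ↭ₛ.foldr-commMonoid (≡.setoid ℤ) ℤP.+-0-isCommutativeMonoid (↭⇒↭ₛ p)

Unique-resp-↭ : ∀ {xs ys : List ℤ} → xs ↭ ys → Unique xs → Unique ys
Unique-resp-↭ p = ↭ₛ.Unique-resp-↭ (≡.setoid ℤ) (↭⇒↭ₛ p)

InRestrictedSumset-resp-↭ : ∀ {h xs ys s} → xs ↭ ys → InRestrictedSumset h xs s → InRestrictedSumset h ys s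
InRestrictedSumset-resp-↭ p (bs , bs⊆xs , |bs| , Σbs) with ↭-lift-⊆ p bs⊆xs
... | bs′ , bs′⊆ys , q = bs′ , bs′⊆ys , ≡.trans (sym (↭-length q)) |bs| , ≡.trans (sym (sumℤ-↭ q)) Σbs

-- Out of range, nth returns the junk value 0.
nth : List ℤ → ℕ → ℤ
nth []       _       = 0ℤ
nth (x ∷ xs) zero    = x
nth (x ∷ xs) (suc i) = nth xs i

nth-∈ : ∀ xs {i} → i < length xs → nth xs i ∈ xs
nth-∈ (x ∷ xs) {zero}  _        = here ≡.refl
nth-∈ (x ∷ xs) {suc i} (s≤s i<) = there (nth-∈ xs i<)

∈⇒nth : ∀ {xs z} → z ∈ xs → ∃ λ i → i < length xs × nth xs i ≡ z
∈⇒nth (here z≡x) = 0 , s≤s z≤n , sym z≡x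
∈⇒nth (there p) with ∈⇒nth p
... | i , i< , eq = suc i , s≤s i< , eq

head≤nth : ∀ {x xs} → Sorted (x ∷ xs) → ∀ j → j < length (x ∷ xs) → x ≤ℤ nth (x ∷ xs) j
head≤nth _ zero _ = ℤP.≤-refl
head≤nth {xs = y ∷ xs} (x≤y ∷ s) (suc j) (s≤s j<) = ℤP.≤-trans x≤y (head≤nth s j j<)

nth-mono-≤ : ∀ {xs} → Sorted xs → ∀ {i j} → i ≤ j → j < length xs → nth xs i ≤ℤ nth xs j
nth-mono-≤ {_ ∷ _}      s       {zero}  {j}     _         j<       = head≤nth s j j<
nth-mono-≤ {_ ∷ _ ∷ _}  (_ ∷ s) {suc i} {suc j} (s≤s i≤j) (s≤s j<) = nth-mono-≤ s i≤j j<

nth-strict : ∀ {xs} → Sorted xs → Unique xs → ∀ i → suc i < length xs → nth xs i <ℤ nth xs (suc i)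
nth-strict {_ ∷ []}    _         _               _       (s≤s ())
nth-strict {_ ∷ _ ∷ _} (x≤y ∷ _) ((x≢y ∷ _) ∷ _) zero    _        = ℤP.≤∧≢⇒< x≤y x≢y
nth-strict {_ ∷ _ ∷ _} (_ ∷ s)   (_ ∷ u)         (suc i) (s≤s i<) = nth-strict s u i i<

sumRange : (ℕ → ℤ) → ℕ → ℕ → ℤ
sumRange a t zero    = 0ℤ
sumRange a t (suc m) = a t +ℤ sumRange a (suc t) m

sumRange-snoc : ∀ a t m → sumRange a t (suc m) ≡ sumRange a t m +ℤ a (t + m)
sumRange-snoc a t zero = begin
  a t +ℤ 0ℤ        ≡⟨ ℤP.+-identityʳ (a t) ⟩
  a t              ≡⟨ cong a (sym (ℕP.+-identityʳ t)) ⟩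
  a (t + 0)        ≡⟨ sym (ℤP.+-identityˡ _) ⟩
  0ℤ +ℤ a (t + 0)  ∎
  where open ≡.≡-Reasoning
sumRange-snoc a t (suc m) = begin
  a t +ℤ sumRange a (suc t) (suc m)                ≡⟨ cong (a t +ℤ_) (sumRange-snoc a (suc t) m) ⟩
  a t +ℤ (sumRange a (suc t) m +ℤ a (suc t + m))   ≡⟨ sym (ℤP.+-assoc (a t) _ _) ⟩
  sumRange a t (suc m) +ℤ a (suc t + m)            ≡⟨ cong (λ i → sumRange a t (suc m) +ℤ a i) (sym (ℕP.+-suc t m)) ⟩
  sumRange a t (suc m) +ℤ a (t + suc m)            ∎
  where open ≡.≡-Reasoning

sumRange-nth-∷ : ∀ x xs t m → sumRange (nth (x ∷ xs)) (suc t) m ≡ sumRange (nth xs) t m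
sumRange-nth-∷ x xs t zero    = ≡.refl
sumRange-nth-∷ x xs t (suc m) = cong (nth xs t +ℤ_) (sumRange-nth-∷ x xs (suc t) m)

sumRange-suc-mono : ∀ {xs} → Sorted xs → ∀ t m → t + m < length xs →
                    sumRange (nth xs) t m ≤ℤ sumRange (nth xs) (suc t) m
sumRange-suc-mono s t zero    _  = ℤP.≤-refl
sumRange-suc-mono {xs} s t (suc m) lt =
  ℤP.+-mono-≤ (nth-mono-≤ s (ℕP.n≤1+n t) (ℕP.≤-trans (s≤s (ℕP.m≤m+n (suc t) m)) lt′))
              (sumRange-suc-mono s (suc t) m lt′)
  where
  lt′ : suc t + m < length xs
  lt′ = subst (_< length xs) (ℕP.+-suc t m) lt

sum-⊆-lower : ∀ {bs xs} → bs ⊆ xs → Sorted xs → sumRange (nth xs) 0 (length bs) ≤ℤ sumℤ bs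
sum-⊆-lower [] _ = ℤP.≤-refl
sum-⊆-lower {bs} {x ∷ xs} (.x ∷ʳ bs⊆xs) s = begin
  sumRange (nth (x ∷ xs)) 0 (length bs) ≤⟨ sumRange-suc-mono s 0 (length bs) (s≤s (length-mono-≤ bs⊆xs)) ⟩
  sumRange (nth (x ∷ xs)) 1 (length bs) ≡⟨ sumRange-nth-∷ x xs 0 (length bs) ⟩
  sumRange (nth xs) 0 (length bs)       ≤⟨ sum-⊆-lower bs⊆xs (Linked.tail s) ⟩
  sumℤ bs                               ∎
  where open ℤP.≤-Reasoning
sum-⊆-lower {_ ∷ bs} {x ∷ xs} (≡.refl ∷ bs⊆xs) s =
  ℤP.+-monoʳ-≤ x (ℤP.≤-trans (ℤP.≤-reflexive (sumRange-nth-∷ x xs 0 (length bs))) (sum-⊆-lower bs⊆xs (Linked.tail s)))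

sum-⊆-upper : ∀ {bs xs} → bs ⊆ xs → Sorted xs → sumℤ bs ≤ℤ sumRange (nth xs) (length xs ∸ length bs) (length bs)
sum-⊆-upper [] _ = ℤP.≤-refl
sum-⊆-upper {bs} {x ∷ xs} (.x ∷ʳ bs⊆xs) s = begin
  sumℤ bs                                                  ≤⟨ sum-⊆-upper bs⊆xs (Linked.tail s) ⟩
  sumRange (nth xs) (length xs ∸ length bs) (length bs)    ≡⟨ sym (sumRange-nth-∷ x xs _ (length bs)) ⟩
  sumRange (nth (x ∷ xs)) (suc (length xs ∸ length bs)) (length bs)
    ≡⟨ cong (λ t → sumRange (nth (x ∷ xs)) t (length bs)) (sym (ℕP.+-∸-assoc 1 (length-mono-≤ bs⊆xs))) ⟩
  sumRange (nth (x ∷ xs)) (suc (length xs) ∸ length bs) (length bs) ∎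
  where open ℤP.≤-Reasoning
sum-⊆-upper {_ ∷ bs} {x ∷ xs} (≡.refl ∷ bs⊆xs) s =
  ℤP.+-mono-≤ (head≤nth s (length xs ∸ length bs) (s≤s (ℕP.m∸n≤m (length xs) (length bs))))
              (ℤP.≤-trans (sum-⊆-upper bs⊆xs (Linked.tail s)) (ℤP.≤-reflexive (sym (sumRange-nth-∷ x xs _ (length bs)))))

select : (ℕ → Bool) → List ℤ → List ℤ
select g []       = []
select g (x ∷ xs) = if g 0 then x ∷ select (λ i → g (suc i)) xs else select (λ i → g (suc i)) xs

select-⊆ : ∀ g xs → select g xs ⊆ xs
select-⊆ g []       = []
select-⊆ g (x ∷ xs) with g 0
... | true  = ≡.refl ∷ select-⊆ (λ i → g (suc i)) xs
... | false = x ∷ʳ select-⊆ (λ i → g (suc i)) xs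

select-cong : ∀ {g g′} xs → (∀ i → g i ≡ g′ i) → select g xs ≡ select g′ xs
select-cong []       _    = ≡.refl
select-cong (x ∷ xs) g≗g′ =
  cong₂ (λ b r → if b then x ∷ r else r) (g≗g′ 0) (select-cong xs (λ i → g≗g′ (suc i)))

select-none : ∀ xs → select (λ _ → false) xs ≡ []
select-none []       = ≡.refl
select-none (_ ∷ xs) = select-none xs

-- The indicator function of [l, l + m).
interval : ℕ → ℕ → ℕ → Bool
interval zero    zero    _       = false
interval zero    (suc m) zero    = true
interval zero    (suc m) (suc i) = interval zero m i
interval (suc l) m       zero    = false
interval (suc l) m       (suc i) = interval l m i

interval-true : ∀ l m i → l ≤ i → i < l + m → interval l m i ≡ true
interval-true zero    zero    i       _         i<       = ⊥-elim (ℕP.n≮0 i<)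
interval-true zero    (suc m) zero    _         _        = ≡.refl
interval-true zero    (suc m) (suc i) _         (s≤s i<) = interval-true zero m i z≤n i<
interval-true (suc l) m       (suc i) (s≤s l≤i) (s≤s i<) = interval-true l m i l≤i i<

select-interval : ∀ xs l m → l + m ≤ length xs →
                  sumℤ (select (interval l m) xs) ≡ sumRange (nth xs) l m × length (select (interval l m) xs) ≡ m
select-interval []       zero    zero    _ = ≡.refl , ≡.refl
select-interval (x ∷ xs) zero    zero    _ = cong sumℤ (select-none xs) , cong length (select-none xs)
select-interval (x ∷ xs) zero    (suc m) (s≤s le) with select-interval xs zero m le
... | Σ≡ , |·|≡ = cong (x +ℤ_) (≡.trans Σ≡ (sym (sumRange-nth-∷ x xs 0 m))) , cong suc |·|≡
select-interval (x ∷ xs) (suc l) m       (s≤s le) with select-interval xs l m le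
... | Σ≡ , |·|≡ = ≡.trans Σ≡ (sym (sumRange-nth-∷ x xs l m)) , |·|≡

select-unset : ∀ {g g′} xs p → p < length xs → g p ≡ true → g′ p ≡ false → (∀ i → i ≢ p → g i ≡ g′ i) →
               sumℤ (select g xs) ≡ sumℤ (select g′ xs) +ℤ nth xs p ×
               length (select g xs) ≡ suc (length (select g′ xs))
select-unset {g} {g′} (x ∷ xs) zero _ gp g′p g≗g′
  rewrite gp | g′p | select-cong {λ i → g (suc i)} {λ i → g′ (suc i)} xs (λ i → g≗g′ (suc i) (λ ())) =
  ℤP.+-comm x _ , ≡.refl
select-unset {g} {g′} (x ∷ xs) (suc p) (s≤s p<) gp g′p g≗g′ with g 0 | g′ 0 | g≗g′ 0 (λ ())
... | true  | .true  | ≡.refl with select-unset xs p p< gp g′p (λ i i≢p → g≗g′ (suc i) (λ e → i≢p (ℕP.suc-injective e)))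
...   | Σ≡ , |·|≡ = ≡.trans (cong (x +ℤ_) Σ≡) (sym (ℤP.+-assoc x _ _)) , cong suc |·|≡
select-unset {g} {g′} (x ∷ xs) (suc p) (s≤s p<) gp g′p g≗g′ | false | .false | ≡.refl =
  select-unset xs p p< gp g′p (λ i i≢p → g≗g′ (suc i) (λ e → i≢p (ℕP.suc-injective e)))

clear : ℕ → (ℕ → Bool) → ℕ → Bool
clear p g i with i ≟ p
... | yes _ = false
... | no  _ = g i

clear-other : ∀ p g i → i ≢ p → clear p g i ≡ g i
clear-other p g i i≢p with i ≟ p
... | yes i≡p = ⊥-elim (i≢p i≡p)
... | no  _   = ≡.refl

select-clear : ∀ xs p g → p < length xs → g p ≡ true →
               sumℤ (select (clear p g) xs) ≡ sumℤ (select g xs) -ℤ nth xs p ×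
               suc (length (select (clear p g) xs)) ≡ length (select g xs)
select-clear xs p g p< gp = Σ≡ , sym (proj₂ unset)
  where
  clear-self : clear p g p ≡ false
  clear-self with p ≟ p
  ... | yes _   = ≡.refl
  ... | no  p≢p = ⊥-elim (p≢p ≡.refl)
  unset = select-unset xs p p< gp clear-self (λ i i≢p → sym (clear-other p g i i≢p))
  Σ≡ : sumℤ (select (clear p g) xs) ≡ sumℤ (select g xs) -ℤ nth xs p
  Σ≡ = ≡.trans (sym ([x+y]-y≡x _ (nth xs p))) (cong (_-ℤ nth xs p) (sym (proj₁ unset)))

InRestrictedSumset-omit-one : ∀ xs h {t p} → t ≤ p → p ≤ t + h → t + suc h ≤ length xs →
           InRestrictedSumset h xs (sumRange (nth xs) t (suc h) -ℤ nth xs p)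
InRestrictedSumset-omit-one xs h {t} {p} t≤p p≤t+h len =
  select g xs , select-⊆ g xs , ℕP.suc-injective (≡.trans (proj₂ cleared) (proj₂ window)) ,
  ≡.trans (proj₁ cleared) (cong (_-ℤ nth xs p) (proj₁ window))
  where
  I = interval t (suc h)
  g = clear p I
  p<t+1+h : p < t + suc h
  p<t+1+h = subst (p <_) (sym (ℕP.+-suc t h)) (s≤s p≤t+h)
  window = select-interval xs t (suc h) len
  cleared = select-clear xs p I (ℕP.<-≤-trans p<t+1+h len) (interval-true t (suc h) p t≤p p<t+1+h)

InRestrictedSumset-omit-two : ∀ xs h {t p q} → t ≤ p → p < q → q ≤ t + suc h → t + suc (suc h) ≤ length xs →
           InRestrictedSumset h xs (sumRange (nth xs) t (suc (suc h)) -ℤ nth xs p -ℤ nth xs q)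
InRestrictedSumset-omit-two xs h {t} {p} {q} t≤p p<q q≤t+1+h len =
  select g₂ xs , select-⊆ g₂ xs ,
  ℕP.suc-injective (ℕP.suc-injective (≡.trans (cong suc (proj₂ cleared₂)) (≡.trans (proj₂ cleared₁) (proj₂ window)))) ,
  ≡.trans (proj₁ cleared₂) (cong (_-ℤ nth xs q) (≡.trans (proj₁ cleared₁) (cong (_-ℤ nth xs p) (proj₁ window))))
  where
  I = interval t (suc (suc h))
  g₁ = clear p I
  g₂ = clear q g₁
  q<t+2+h : q < t + suc (suc h)
  q<t+2+h = subst (q <_) (sym (ℕP.+-suc t (suc h))) (s≤s q≤t+1+h)
  q<len : q < length xs
  q<len = ℕP.<-≤-trans q<t+2+h len
  window = select-interval xs t (suc (suc h)) len
  cleared₁ = select-clear xs p I (ℕP.<-trans p<q q<len) (interval-true t _ p t≤p (ℕP.<-trans p<q q<t+2+h))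
  cleared₂ = select-clear xs q g₁ q<len
               (≡.trans (clear-other p I q (λ q≡p → ℕP.<⇒≢ p<q (sym q≡p)))
                        (interval-true t _ q (ℕP.≤-trans t≤p (ℕP.<⇒≤ p<q)) q<t+2+h))

Unique-bounded-length : ∀ {xs : List ℤ} lo M → Unique xs → (∀ {x} → x ∈ xs → lo ≤ℤ x × x ≤ℤ lo +ℤ + M) →
                        length xs ≤ suc M
Unique-bounded-length {xs} lo M xs-unique bounded =
  ℕP.≤-trans (Unique⇒length≤ xs-unique ∈-interval)
             (ℕP.≤-reflexive (≡.trans (length-map _ (upTo (suc M))) (length-upTo (suc M))))
  where
  x≡lo+[x-lo] : ∀ x lo → x ≡ lo +ℤ (x -ℤ lo)
  x≡lo+[x-lo] = solve-∀
  ∈-interval : ∀ {x} → x ∈ xs → x ∈ map (λ j → lo +ℤ + j) (upTo (suc M))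
  ∈-interval {x} x∈ = subst (_∈ _) (sym (≡.trans (x≡lo+[x-lo] x lo) (cong (lo +ℤ_) (sym +j≡x-lo))))
                        (∈-map⁺ (λ j → lo +ℤ + j) (∈-upTo⁺ (s≤s j≤M)))
    where
    j = ℤ.∣ x -ℤ lo ∣
    +j≡x-lo : + j ≡ x -ℤ lo
    +j≡x-lo = ℤP.0≤i⇒+∣i∣≡i (ℤP.i≤j⇒0≤j-i (proj₁ (bounded x∈)))
    j≤M : j ≤ M
    j≤M = ℤP.drop‿+≤+ (subst₂ _≤ℤ_ (sym +j≡x-lo) ([x+y]-x≡y lo (+ M))
                                     (ℤP.+-monoˡ-≤ (- lo) (proj₂ (bounded x∈))))

x<x+p : ∀ x {p} → 0ℤ <ℤ p → x <ℤ x +ℤ p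
x<x+p x 0<p = subst (_<ℤ x +ℤ _) (ℤP.+-identityʳ x) (ℤP.+-monoʳ-< x 0<p)

x-p<x : ∀ x {p} → 0ℤ <ℤ p → x -ℤ p <ℤ x
x-p<x x 0<p = subst (x -ℤ _ <ℤ_) (ℤP.+-identityʳ x) (ℤP.+-monoʳ-< x (ℤP.neg-mono-< 0<p))

x<s-y : ∀ {x y s} → x +ℤ y <ℤ s → x <ℤ s -ℤ y
x<s-y {x} {y} {s} lt = subst (_<ℤ s -ℤ y) ([x+y]-y≡x x y) (ℤP.+-monoˡ-< (- y) lt)

s-y<x : ∀ {x y s} → s <ℤ x +ℤ y → s -ℤ y <ℤ x
s-y<x {x} {y} {s} lt = subst (s -ℤ y <ℤ_) ([x+y]-y≡x x y) (ℤP.+-monoˡ-< (- y) lt)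

s-y≢x : ∀ {x y s} → x +ℤ y ≢ s → s -ℤ y ≢ x
s-y≢x {x} {y} {s} x+y≢s s-y≡x = x+y≢s (≡.trans (cong (_+ℤ y) (sym s-y≡x)) ([s-y]+y≡s s y))
  where
  [s-y]+y≡s : ∀ s y → (s -ℤ y) +ℤ y ≡ s
  [s-y]+y≡s = solve-∀

module Chain (h L : ℕ) (a : ℕ → ℤ) (a-inc : ∀ i → i ≤ L + h → a i <ℤ a (suc i)) where

  K : ℕ
  K = suc (L + h)

  a-< : ∀ {i j} → i < j → j ≤ K → a i <ℤ a j
  a-< {i} {suc j} (s≤s i≤j) j<K with ℕP.m≤n⇒m<n∨m≡n i≤j
  ... | inj₁ i<j    = ℤP.<-trans (a-< i<j (ℕP.<⇒≤ j<K)) (a-inc j (ℕP.≤-pred j<K))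
  ... | inj₂ ≡.refl = a-inc j (ℕP.≤-pred j<K)

  a-≤ : ∀ {i j} → i ≤ j → j ≤ K → a i ≤ℤ a j
  a-≤ i≤j j≤K with ℕP.m≤n⇒m<n∨m≡n i≤j
  ... | inj₁ i<j    = ℤP.<⇒≤ (a-< i<j j≤K)
  ... | inj₂ ≡.refl = ℤP.≤-refl

  window : ℕ → ℤ
  window t = sumRange a t h

  blockSum : ℕ → ℤ
  blockSum t = sumRange a t (suc h)

  omit : ℕ → ℕ → ℤ
  omit t m = blockSum t -ℤ a m

  omit-first : ∀ t → omit t t ≡ window (suc t)
  omit-first t = [x+y]-x≡y (a t) (window (suc t))

  window≡omit-last : ∀ t → window t ≡ omit t (t + h)
  window≡omit-last t = ≡.trans (sym ([x+y]-y≡x (window t) (a (t + h)))) (cong (_-ℤ a (t + h)) (sym (sumRange-snoc a t h)))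

  omit-anti-≤ : ∀ t {m m′} → m ≤ m′ → m′ ≤ K → omit t m′ ≤ℤ omit t m
  omit-anti-≤ t m≤m′ m′≤K = ℤP.+-monoʳ-≤ (blockSum t) (ℤP.neg-mono-≤ (a-≤ m≤m′ m′≤K))

  omit-anti-< : ∀ t {m m′} → m < m′ → m′ ≤ K → omit t m′ <ℤ omit t m
  omit-anti-< t m<m′ m′≤K = ℤP.+-monoʳ-< (blockSum t) (ℤP.neg-mono-< (a-< m<m′ m′≤K))

  +h≤K : ∀ {t} → t ≤ suc L → t + h ≤ K
  +h≤K t≤ = ℕP.+-monoˡ-≤ h t≤

  window≤omit : ∀ {t m} → t ≤ suc L → m ≤ t + h → window t ≤ℤ omit t m
  window≤omit {t} t≤ m≤ = subst (_≤ℤ omit t _) (sym (window≡omit-last t)) (omit-anti-≤ t m≤ (+h≤K t≤))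

  omit≤window : ∀ {t m} → t ≤ m → m ≤ K → omit t m ≤ℤ window (suc t)
  omit≤window {t} t≤m m≤K = subst (omit t _ ≤ℤ_) (omit-first t) (omit-anti-≤ t t≤m m≤K)

  window-mono : ∀ {t t′} → t ≤ t′ → t′ ≤ suc (suc L) → window t ≤ℤ window t′
  window-mono {t} {t′} t≤t′ t′≤ with ℕP.m≤n⇒m<n∨m≡n t≤t′
  ... | inj₂ ≡.refl = ℤP.≤-refl
  window-mono {t} {suc t′} _ t′≤ | inj₁ (s≤s t≤t′) = ℤP.≤-trans (window-mono t≤t′ (ℕP.<⇒≤ t′≤)) step
    where
    t′≤L+1 = ℕP.≤-pred t′≤
    step : window t′ ≤ℤ window (suc t′)
    step = ℤP.≤-trans (window≤omit t′≤L+1 (ℕP.m≤m+n t′ h))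
                      (omit≤window ℕP.≤-refl (ℕP.≤-trans (ℕP.m≤m+n t′ h) (+h≤K t′≤L+1)))

  window-suc : ∀ t → window (suc t) ≡ window t +ℤ (a (t + h) -ℤ a t)
  window-suc t = begin
    window (suc t)                      ≡⟨ sym (omit-first t) ⟩
    sumRange a t (suc h) -ℤ a t         ≡⟨ cong (_-ℤ a t) (sumRange-snoc a t h) ⟩
    (window t +ℤ a (t + h)) -ℤ a t      ≡⟨ [x+y]-z≡x+[y-z] (window t) (a (t + h)) (a t) ⟩
    window t +ℤ (a (t + h) -ℤ a t)      ∎
    where
    open ≡.≡-Reasoning
    [x+y]-z≡x+[y-z] : ∀ x y z → (x +ℤ y) -ℤ z ≡ x +ℤ (y -ℤ z)
    [x+y]-z≡x+[y-z] = solve-∀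

  -- The chain passes through window 0 < window 1 < … < window (2 + L); between window t and
  -- window (t + 1) = omit t t it visits omit t m for m = t + h − 1, …, t + 1.
  block : ℕ → ℕ → List ℤ
  block t zero    = []
  block t (suc j) = omit t (t + suc j) ∷ block t j

  chainFrom : ℕ → ℕ → List ℤ
  chainFrom t zero    = window t ∷ []
  chainFrom t (suc r) = block t h ++ chainFrom (suc t) r

  chain : List ℤ
  chain = chainFrom 0 (suc (suc L))

  ∈-block : ∀ {t j x} → x ∈ block t j → ∃ λ m → t < m × m ≤ t + j × x ≡ omit t m
  ∈-block {t} {suc j} (here x≡) = t + suc j , ℕP.m<m+n t (s≤s z≤n) , ℕP.≤-refl , x≡
  ∈-block {t} {suc j} (there p) with ∈-block p
  ... | m , t<m , m≤ , x≡ = m , t<m , ℕP.≤-trans m≤ (ℕP.+-monoʳ-≤ t (ℕP.n≤1+n j)) , x≡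

  ChainFromElem : ℕ → ℕ → ℤ → Set
  ChainFromElem t r x =
    (∃ λ t′ → ∃ λ m → t ≤ t′ × t′ < t + r × t′ < m × m ≤ t′ + h × x ≡ omit t′ m) ⊎ x ≡ window (t + r)

  ∈-chainFrom : ∀ {t r x} → x ∈ chainFrom t r → ChainFromElem t r x
  ∈-chainFrom {t} {zero} (here x≡) = inj₂ (≡.trans x≡ (cong window (sym (ℕP.+-identityʳ t))))
  ∈-chainFrom {t} {suc r} p with ∈-++⁻ (block t h) p
  ... | inj₁ q with ∈-block q
  ...   | m , t<m , m≤ , x≡ = inj₁ (t , m , ℕP.≤-refl , ℕP.m<m+n t (s≤s z≤n) , t<m , m≤ , x≡)
  ∈-chainFrom {t} {suc r} p | inj₂ q with ∈-chainFrom {suc t} {r} q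
  ...   | inj₁ (t′ , m , t<t′ , t′< , t′<m , m≤ , x≡) =
          inj₁ (t′ , m , ℕP.<⇒≤ t<t′ , subst (t′ <_) (sym (ℕP.+-suc t r)) t′< , t′<m , m≤ , x≡)
  ...   | inj₂ x≡ = inj₂ (≡.trans x≡ (cong window (sym (ℕP.+-suc t r))))

  ∈-chain : ∀ {x} → x ∈ chain →
            (∃ λ t → ∃ λ m → t ≤ suc L × t < m × m ≤ t + h × x ≡ omit t m) ⊎ x ≡ window (suc (suc L))
  ∈-chain p with ∈-chainFrom p
  ... | inj₁ (t , m , _ , t< , t<m , m≤ , x≡) = inj₁ (t , m , ℕP.≤-pred t< , t<m , m≤ , x≡)
  ... | inj₂ x≡ = inj₂ x≡

  chain-length : length chain ≡ 1 + (2 + L) * h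
  chain-length = length-chainFrom 0 (suc (suc L))
    where
    length-block : ∀ t j → length (block t j) ≡ j
    length-block t zero    = ≡.refl
    length-block t (suc j) = cong suc (length-block t j)
    length-chainFrom : ∀ t r → length (chainFrom t r) ≡ suc (r * h)
    length-chainFrom t zero    = ≡.refl
    length-chainFrom t (suc r) =
      ≡.trans (length-++ (block t h))
              (≡.trans (cong₂ _+_ (length-block t h) (length-chainFrom (suc t) r)) (ℕP.+-suc h (r * h)))

  chain-increasing : AllPairs _<ℤ_ chain
  chain-increasing = chainFrom-increasing 0 (suc (suc L)) ℕP.≤-refl
    where
    block-increasing : ∀ t j → j ≤ h → t ≤ suc L → AllPairs _<ℤ_ (block t j)
    block-increasing t zero    _   _  = []
    block-increasing t (suc j) j≤h t≤ = All.tabulate above ∷ block-increasing t j (ℕP.<⇒≤ j≤h) t≤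
      where
      above : ∀ {x} → x ∈ block t j → omit t (t + suc j) <ℤ x
      above p with ∈-block p
      ... | m , _ , m≤ , ≡.refl = omit-anti-< t (ℕP.≤-trans (s≤s m≤) (ℕP.≤-reflexive (sym (ℕP.+-suc t j))))
                                    (ℕP.≤-trans (ℕP.+-monoʳ-≤ t j≤h) (+h≤K t≤))
    window≤chainFrom : ∀ {t r x} → x ∈ chainFrom t r → t + r ≤ suc (suc L) → window t ≤ℤ x
    window≤chainFrom {t} {r} p t+r≤ with ∈-chainFrom p
    ... | inj₁ (t′ , m , t≤t′ , t′< , _ , m≤ , ≡.refl) =
          ℤP.≤-trans (window-mono t≤t′ (ℕP.≤-trans (ℕP.<⇒≤ t′<) t+r≤))
                     (window≤omit (ℕP.≤-pred (ℕP.≤-trans t′< t+r≤)) m≤)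
    ... | inj₂ ≡.refl = window-mono (ℕP.m≤m+n t r) t+r≤
    chainFrom-increasing : ∀ t r → t + r ≤ suc (suc L) → AllPairs _<ℤ_ (chainFrom t r)
    chainFrom-increasing t zero    _    = [] ∷ []
    chainFrom-increasing t (suc r) t+r≤ =
      AllPairsₚ.++⁺ (block-increasing t h ℕP.≤-refl t≤) (chainFrom-increasing (suc t) r t+r≤′)
                   (All.tabulate (λ px → All.tabulate (λ py → below px py)))
      where
      t+r≤′ : suc t + r ≤ suc (suc L)
      t+r≤′ = subst (_≤ suc (suc L)) (ℕP.+-suc t r) t+r≤
      t≤ : t ≤ suc L
      t≤ = ℕP.≤-pred (ℕP.≤-trans (s≤s (ℕP.m≤m+n t r)) t+r≤′)
      below : ∀ {x y} → x ∈ block t h → y ∈ chainFrom (suc t) r → x <ℤ y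
      below px py with ∈-block px
      ... | m , t<m , m≤ , ≡.refl =
            ℤP.<-≤-trans (subst (omit t m <ℤ_) (omit-first t) (omit-anti-< t t<m (ℕP.≤-trans m≤ (+h≤K t≤))))
                         (window≤chainFrom py t+r≤′)

  chain-unique : Unique chain
  chain-unique = AllPairs.map ℤP.<⇒≢ chain-increasing

  ∉chain-between : ∀ {t e} → t ≤ suc L → window t <ℤ e → e <ℤ window (suc t) →
                   (∀ m → t < m → m ≤ t + h → e ≢ omit t m) → e ∉ chain
  ∉chain-between {t} t≤ lo hi ≢omit p with ∈-chain p
  ... | inj₂ ≡.refl = ℤP.<-irrefl ≡.refl (ℤP.<-≤-trans hi (window-mono (s≤s t≤) ℕP.≤-refl))
  ... | inj₁ (t′ , m , t′≤ , t′<m , m≤ , ≡.refl) with ℕP.<-cmp t′ t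
  ...   | tri< t′<t _ _ = ℤP.<-irrefl ≡.refl (ℤP.≤-<-trans below lo)
    where
    below : omit t′ m ≤ℤ window t
    below = ℤP.≤-trans (omit≤window (ℕP.<⇒≤ t′<m) (ℕP.≤-trans m≤ (+h≤K t′≤)))
                       (window-mono t′<t (ℕP.m≤n⇒m≤1+n t≤))
  ...   | tri> _ _ t<t′ = ℤP.<-irrefl ≡.refl (ℤP.<-≤-trans hi above)
    where
    above : window (suc t) ≤ℤ omit t′ m
    above = ℤP.≤-trans (window-mono t<t′ (ℕP.m≤n⇒m≤1+n t′≤)) (window≤omit t′≤ m≤)
  ...   | tri≈ _ ≡.refl _ = ≢omit m t′<m m≤ ≡.refl

  InGap : ℕ → ℕ → ℤ → Set
  InGap t m e = t ≤ suc L × t ≤ m × m < t + h × omit t (suc m) <ℤ e × e <ℤ omit t m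

  InGap⇒∉chain : ∀ {t m e} → InGap t m e → e ∉ chain
  InGap⇒∉chain {t} {m} (t≤ , t≤m , m< , lo , hi) =
    ∉chain-between t≤ (ℤP.≤-<-trans (window≤omit t≤ m<) lo) (ℤP.<-≤-trans hi (omit≤window t≤m m≤K)) ≢omit
    where
    m≤K : m ≤ K
    m≤K = ℕP.<⇒≤ (ℕP.<-≤-trans m< (+h≤K t≤))
    ≢omit : ∀ m′ → t < m′ → m′ ≤ t + h → _ ≢ omit t m′
    ≢omit m′ _ m′≤ ≡.refl with m′ ℕP.≤? m
    ... | yes m′≤m = ℤP.<-irrefl ≡.refl (ℤP.<-≤-trans hi (omit-anti-≤ t m′≤m m≤K))
    ... | no  m′≰m = ℤP.<-irrefl ≡.refl
                     (ℤP.≤-<-trans (omit-anti-≤ t (ℕP.≰⇒> m′≰m) (ℕP.≤-trans m′≤ (+h≤K t≤))) lo)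

  InGap-< : ∀ {t₁ m₁ e₁ t₂ m₂ e₂} → InGap t₁ m₁ e₁ → InGap t₂ m₂ e₂ →
            t₁ < t₂ ⊎ (t₁ ≡ t₂ × m₂ < m₁) → e₁ <ℤ e₂
  InGap-< (t₁≤ , t₁≤m₁ , m₁< , _ , hi₁) (t₂≤ , _ , m₂< , lo₂ , _) (inj₁ t₁<t₂) = begin-strict
    _                  <⟨ hi₁ ⟩
    omit _ _           ≤⟨ omit≤window t₁≤m₁ (ℕP.<⇒≤ (ℕP.<-≤-trans m₁< (+h≤K t₁≤))) ⟩
    window _           ≤⟨ window-mono t₁<t₂ (ℕP.m≤n⇒m≤1+n t₂≤) ⟩
    window _           ≤⟨ window≤omit t₂≤ m₂< ⟩
    omit _ _           <⟨ lo₂ ⟩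
    _                  ∎
    where open ℤP.≤-Reasoning
  InGap-< {t₁} (t₁≤ , _ , m₁< , _ , hi₁) (_ , _ , _ , lo₂ , _) (inj₂ (≡.refl , m₂<m₁)) =
    ℤP.<-trans hi₁ (ℤP.≤-<-trans (omit-anti-≤ t₁ m₂<m₁ (ℕP.<⇒≤ (ℕP.<-≤-trans m₁< (+h≤K t₁≤)))) lo₂)

  InGap-injective : ∀ {t₁ m₁ t₂ m₂ e} → InGap t₁ m₁ e → InGap t₂ m₂ e → t₁ ≡ t₂ × m₁ ≡ m₂
  InGap-injective {t₁} {m₁} {t₂} {m₂} g₁ g₂ with ℕP.<-cmp t₁ t₂ | ℕP.<-cmp m₁ m₂
  ... | tri< t₁<t₂ _ _ | _              = ⊥-elim (ℤP.<-irrefl ≡.refl (InGap-< g₁ g₂ (inj₁ t₁<t₂)))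
  ... | tri> _ _ t₂<t₁ | _              = ⊥-elim (ℤP.<-irrefl ≡.refl (InGap-< g₂ g₁ (inj₁ t₂<t₁)))
  ... | tri≈ _ t₁≡t₂ _ | tri< m₁<m₂ _ _ =
      ⊥-elim (ℤP.<-irrefl ≡.refl (InGap-< g₂ g₁ (inj₂ (sym t₁≡t₂ , m₁<m₂))))
  ... | tri≈ _ t₁≡t₂ _ | tri> _ _ m₂<m₁ =
      ⊥-elim (ℤP.<-irrefl ≡.refl (InGap-< g₁ g₂ (inj₂ (t₁≡t₂ , m₂<m₁))))
  ... | tri≈ _ t₁≡t₂ _ | tri≈ _ m₁≡m₂ _ = t₁≡t₂ , m₁≡m₂

  blockSum-minus-anti : ∀ t {u v} → u <ℤ v → blockSum t -ℤ v <ℤ blockSum t -ℤ u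
  blockSum-minus-anti t u<v = ℤP.+-monoʳ-< (blockSum t) (ℤP.neg-mono-< u<v)

  InGap-below : ∀ {t m r} → t ≤ suc L → t ≤ m → m < t + h → a m <ℤ r → r <ℤ a (suc m) →
                InGap t m (blockSum t -ℤ r)
  InGap-below {t} t≤ t≤m m< am<r r<am+1 = t≤ , t≤m , m< , blockSum-minus-anti t r<am+1 , blockSum-minus-anti t am<r

  ∉chain-below : ∀ {t r} → t ≤ suc L → a t <ℤ r → r <ℤ a (t + h) → (∀ m → t < m → m ≤ t + h → r ≢ a m) →
                 blockSum t -ℤ r ∉ chain
  ∉chain-below {t} {r} t≤ at<r r<at+h r≢ =
    ∉chain-between t≤ (subst (_<ℤ F -ℤ r) (sym (window≡omit-last t)) (blockSum-minus-anti t r<at+h))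
                      (subst (F -ℤ r <ℤ_) (omit-first t) (blockSum-minus-anti t at<r))
                      (λ m t<m m≤ eq → r≢ m t<m m≤ (cancel eq))
    where
    F = blockSum t
    x≡F-[F-x] : ∀ F x → x ≡ F -ℤ (F -ℤ x)
    x≡F-[F-x] = solve-∀
    cancel : ∀ {u v} → F -ℤ u ≡ F -ℤ v → u ≡ v
    cancel {u} {v} eq = ≡.trans (x≡F-[F-x] F u) (≡.trans (cong (F -ℤ_) eq) (sym (x≡F-[F-x] F v)))

module Steps (h L : ℕ) (3≤h : 3 ≤ h) (2h≤L+1 : h + h ≤ suc L) (d : ℕ → ℤ) where

  n : ℕ
  n = L + h

  -- For the steps d j = a (j + 1) − a j of an increasing sequence, Rise x y and Fall x y are
  -- the conditions under which leaving out a (x + 1) and a y from h + 2 consecutive elements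
  -- yields a sum strictly inside a gap of the chain.
  Rise : ℕ → ℕ → Set
  Rise x y = x ≤ L × 2 + x ≤ y × y ≤ x + h × d x <ℤ d y

  Fall : ℕ → ℕ → Set
  Fall x y = h ≤ y × y ≤ n × 2 + x ≤ y × y ≤ x + h × d y <ℤ d x

  LargeFirstStep : Set
  LargeFirstStep = (∀ j → 1 ≤ j → j ≤ n → d j ≡ d 1) × d 1 ≤ℤ d 0

  LargeLastStep : Set
  LargeLastStep = (∀ j → j < n → d j ≡ d 0) × d 0 ≤ℤ d n

  1≤h : 1 ≤ h
  1≤h = ℕP.≤-trans (s≤s z≤n) 3≤h

  2≤h : 2 ≤ h
  2≤h = ℕP.≤-trans (s≤s (s≤s z≤n)) 3≤h

  2+h≤L : 2 + h ≤ L
  2+h≤L = ℕP.≤-pred (ℕP.≤-trans (ℕP.+-monoˡ-≤ h 3≤h) 2h≤L+1)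

  h<L : h < L
  h<L = ℕP.<-trans (ℕP.n<1+n h) 2+h≤L

  L<n : L < n
  L<n = ℕP.m<m+n L 1≤h

  h≤n : h ≤ n
  h≤n = ℕP.m≤n+m h L

  2+x≤x+h : ∀ x → 2 + x ≤ x + h
  2+x≤x+h x = subst (_≤ x + h) (ℕP.+-comm x 2) (ℕP.+-monoʳ-≤ x 2≤h)

  3+x≤x+h : ∀ x → 3 + x ≤ x + h
  3+x≤x+h x = subst (_≤ x + h) (ℕP.+-comm x 3) (ℕP.+-monoʳ-≤ x 3≤h)

  x+h≤n : ∀ {x} → x ≤ L → x + h ≤ n
  x+h≤n = ℕP.+-monoˡ-≤ h

  L<m+h⇒h≤m : ∀ {m} → L < m + h → h ≤ m
  L<m+h⇒h≤m {m} L<m+h = ℕP.+-cancelʳ-≤ h h m (ℕP.≤-trans 2h≤L+1 L<m+h)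

  h≤j⇒j≢0 : ∀ {j} → h ≤ j → j ≢ 0
  h≤j⇒j≢0 h≤j j≡0 = ℕP.<⇒≢ (ℕP.≤-trans 1≤h h≤j) (sym j≡0)

  some-Rise? : Dec (∃₂ Rise)
  some-Rise? = map′ (λ (x , _ , y , _ , r) → x , y , r)
                    (λ (x , y , r@(x≤L , _ , y≤ , _)) → x , s≤s x≤L , y , s≤s (ℕP.≤-trans y≤ (x+h≤n x≤L)) , r)
                    (ℕP.anyUpTo? (λ x → ℕP.anyUpTo? (Rise? x) (suc n)) (suc L))
    where
    Rise? : ∀ x y → Dec (Rise x y)
    Rise? x y = (x ℕP.≤? L) ×-dec ((2 + x ℕP.≤? y) ×-dec ((y ℕP.≤? x + h) ×-dec (d x ℤP.<? d y)))

  some-Fall? : Dec (∃₂ Fall)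
  some-Fall? = map′ (λ (x , _ , y , _ , f) → x , y , f)
                    (λ (x , y , f@(_ , y≤n , 2+x≤y , _)) → x , s≤s (ℕP.≤-trans (ℕP.m≤n+m x 2) (ℕP.≤-trans 2+x≤y y≤n)) ,
                      y , s≤s y≤n , f)
                    (ℕP.anyUpTo? (λ x → ℕP.anyUpTo? (Fall? x) (suc n)) (suc n))
    where
    Fall? : ∀ x y → Dec (Fall x y)
    Fall? x y = (h ℕP.≤? y) ×-dec ((y ℕP.≤? n) ×-dec ((2 + x ℕP.≤? y) ×-dec ((y ℕP.≤? x + h) ×-dec (d y ℤP.<? d x))))

  exceptional-index : (∀ {x y x′ y′} → Rise x y → Rise x′ y′ → y ≡ y′) →
                      (∀ {x y x′ y′} → Fall x y → Fall x′ y′ → x ≡ x′) →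
                      (∀ {x y x′ y′} → Rise x y → Fall x′ y′ → y ≡ x′) →
                      ∃ λ z → (∀ {x y} → Rise x y → y ≡ z) × (∀ {x y} → Fall x y → x ≡ z)
  exceptional-index rise-rise fall-fall rise-fall with some-Rise? | some-Fall?
  ... | yes (_ , y₀ , r₀) | _                 = y₀ , (λ r → sym (rise-rise r₀ r)) , (λ f → sym (rise-fall r₀ f))
  ... | no  no-rise       | yes (x₀ , _ , f₀) = x₀ , (λ r → ⊥-elim (no-rise (_ , _ , r))) , (λ f → fall-fall f f₀)
  ... | no  no-rise       | no  no-fall       = 0 , (λ r → ⊥-elim (no-rise (_ , _ , r))) , (λ f → ⊥-elim (no-fall (_ , _ , f)))

  RiseUnique : Set
  RiseUnique = ∀ {x y x′ y′} → Rise x y → Rise x′ y′ → x ≡ x′ × y ≡ y′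

  FallUnique : Set
  FallUnique = ∀ {x y x′ y′} → Fall x y → Fall x′ y′ → x ≡ x′ × y ≡ y′

  module Exceptional (z : ℕ) (rise⇒ : ∀ {x y} → Rise x y → y ≡ z) (fall⇒ : ∀ {x y} → Fall x y → x ≡ z) where

    rise-free : ∀ {x y} → x ≤ L → 2 + x ≤ y → y ≤ x + h → y ≢ z → d y ≤ℤ d x
    rise-free x≤L 2+x≤y y≤ y≢z = ℤP.≮⇒≥ (λ dx<dy → y≢z (rise⇒ (x≤L , 2+x≤y , y≤ , dx<dy)))

    fall-free : ∀ {x y} → h ≤ y → y ≤ n → 2 + x ≤ y → y ≤ x + h → x ≢ z → d x ≤ℤ d y
    fall-free h≤y y≤n 2+x≤y y≤ x≢z = ℤP.≮⇒≥ (λ dy<dx → x≢z (fall⇒ (h≤y , y≤n , 2+x≤y , y≤ , dy<dx)))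

    link : ∀ {x y} → x ≤ L → h ≤ y → 2 + x ≤ y → y ≤ x + h → x ≢ z → y ≢ z → d x ≡ d y
    link x≤L h≤y 2+x≤y y≤ x≢z y≢z =
      ℤP.≤-antisym (fall-free h≤y (ℕP.≤-trans y≤ (x+h≤n x≤L)) 2+x≤y y≤ x≢z) (rise-free x≤L 2+x≤y y≤ y≢z)

    link-suc : ∀ p → suc (p + h) ≤ L → p + h ≢ z → suc (p + h) ≢ z → d (p + h) ≡ d (suc (p + h))
    link-suc p le i≢z i+1≢z with p + h + h ≟ z
    ... | no i+h≢z =
          ≡.trans (link i≤L (ℕP.m≤n+m h (p + h)) (2+x≤x+h (p + h)) ℕP.≤-refl i≢z i+h≢z)
                  (sym (link le (ℕP.m≤n+m h (p + h)) (3+x≤x+h (p + h)) (ℕP.n≤1+n _) i+1≢z i+h≢z))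
      where i≤L = ℕP.<⇒≤ le
    ... | yes i+h≡z =
          ≡.trans (sym (link p+1≤L (ℕP.m≤n+m h p) (3+x≤x+h p) (ℕP.n≤1+n _) p+1≢z i≢z))
                  (link p+1≤L (ℕP.≤-trans (ℕP.m≤n+m h p) (ℕP.n≤1+n _)) (s≤s (2+x≤x+h p)) ℕP.≤-refl p+1≢z i+1≢z)
      where
      p+1≤L : suc p ≤ L
      p+1≤L = ℕP.≤-trans (s≤s (ℕP.m≤m+n p h)) le
      p+1≢z : suc p ≢ z
      p+1≢z p+1≡z = ℕP.<⇒≢ (ℕP.≤-trans (2+x≤x+h p) (ℕP.m≤m+n (p + h) h)) (≡.trans p+1≡z (sym i+h≡z))

    -- The common value of the steps; d h itself is avoided when h is the exceptional index.
    c : ℤ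
    c with h ≟ z
    ... | yes _ = d (suc h)
    ... | no  _ = d h

    d≡c-from-h : ∀ m → m + h ≤ L → m + h ≢ z → d (m + h) ≡ c
    d≡c-from-h zero _ h≢z with h ≟ z
    ... | yes h≡z = ⊥-elim (h≢z h≡z)
    ... | no  _   = ≡.refl
    d≡c-from-h (suc zero) le h+1≢z with h ≟ z
    ... | yes _   = ≡.refl
    ... | no  h≢z = sym (link-suc 0 le h≢z h+1≢z)
    d≡c-from-h (suc (suc m)) = two-steps (d≡c-from-h (suc m)) (d≡c-from-h m)
      where
      two-steps : (suc m + h ≤ L → suc m + h ≢ z → d (suc m + h) ≡ c) →
                  (m + h ≤ L → m + h ≢ z → d (m + h) ≡ c) →
                  suc (suc m) + h ≤ L → suc (suc m) + h ≢ z → d (suc (suc m) + h) ≡ c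
      two-steps ih₁ ih₂ le i≢z with suc m + h ≟ z
      ... | no  i-1≢z = ≡.trans (sym (link-suc (suc m) le i-1≢z i≢z)) (ih₁ (ℕP.<⇒≤ le) i-1≢z)
      ... | yes i-1≡z = ≡.trans (sym (link i-2≤L (ℕP.≤-trans (ℕP.m≤n+m h m) (ℕP.m≤n⇒m≤1+n (ℕP.n≤1+n _)))
                                           ℕP.≤-refl (2+x≤x+h (m + h)) i-2≢z i≢z))
                                (ih₂ i-2≤L i-2≢z)
        where
        i-2≤L : m + h ≤ L
        i-2≤L = ℕP.≤-trans (ℕP.m≤n⇒m≤1+n (ℕP.n≤1+n _)) le
        i-2≢z : m + h ≢ z
        i-2≢z i-2≡z = ℕP.1+n≢n (≡.trans i-1≡z (sym i-2≡z))

    d≡c-middle : ∀ i → h ≤ i → i ≤ L → i ≢ z → d i ≡ c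
    d≡c-middle i h≤i i≤L i≢z = subst (λ j → d j ≡ c) i-h+h≡i
      (d≡c-from-h (i ∸ h) (subst (_≤ L) (sym i-h+h≡i) i≤L) (subst (_≢ z) (sym i-h+h≡i) i≢z))
      where i-h+h≡i = ℕP.m∸n+n≡m h≤i

    d≡c-low : ∀ j → j < h → j ≢ z → (j ≡ 0 → h ≢ z) → d j ≡ c
    d≡c-low j j<h j≢z exception with j + h ≟ z
    ... | no j+h≢z = ≡.trans (link j≤L (ℕP.m≤n+m h j) (2+x≤x+h j) ℕP.≤-refl j≢z j+h≢z) (d≡c-from-h j j+h≤L j+h≢z)
      where
      j+h≤L : j + h ≤ L
      j+h≤L = ℕP.≤-pred (ℕP.≤-trans (ℕP.+-monoˡ-≤ h j<h) 2h≤L+1)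
      j≤L : j ≤ L
      j≤L = ℕP.≤-trans (ℕP.m≤m+n j h) j+h≤L
    d≡c-low zero    _ _ exception | yes h≡z = ⊥-elim (exception ≡.refl h≡z)
    d≡c-low (suc j) j<h j≢z _     | yes j+h≡z =
      ≡.trans (link (ℕP.≤-trans (ℕP.<⇒≤ j<h) (ℕP.<⇒≤ h<L))
              (ℕP.m≤n+m h j) (3+x≤x+h j) (ℕP.n≤1+n _) j≢z j+h-1≢z)
              (d≡c-from-h j j+h-1≤L j+h-1≢z)
      where
      j+h-1≤L : j + h ≤ L
      j+h-1≤L = ℕP.<⇒≤ (ℕP.≤-pred (ℕP.≤-trans (ℕP.+-monoˡ-≤ h j<h) 2h≤L+1))
      j+h-1≢z : j + h ≢ z
      j+h-1≢z e = ℕP.1+n≢n (≡.trans j+h≡z (sym e))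

    d≡c-high : ∀ m → m ≤ L → L < m + h → m + h ≢ z → (m ≡ L → L ≢ z) → d (m + h) ≡ c
    d≡c-high m m≤L L<m+h m+h≢z exception with m ≟ z
    ... | no  m≢z = ≡.trans (sym (link m≤L (ℕP.m≤n+m h m) (2+x≤x+h m) ℕP.≤-refl m≢z m+h≢z))
                        (d≡c-middle m (L<m+h⇒h≤m L<m+h) m≤L m≢z)
    ... | yes m≡z = ≡.trans (sym (link m+1≤L (ℕP.m≤n+m h m) (3+x≤x+h m) (ℕP.n≤1+n _) m+1≢z m+h≢z))
                            (d≡c-middle (suc m) (ℕP.m≤n⇒m≤1+n (L<m+h⇒h≤m L<m+h)) m+1≤L m+1≢z)
      where
      m+1≤L : suc m ≤ L
      m+1≤L = ℕP.≤∧≢⇒< m≤L (λ m≡L → exception m≡L (≡.trans (sym m≡L) m≡z))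
      m+1≢z : suc m ≢ z
      m+1≢z e = ℕP.1+n≢n (≡.trans e (sym m≡z))

    d≡c : ∀ j → j ≤ n → j ≢ z → (j ≡ 0 → h ≢ z) → (j ≡ n → L ≢ z) → d j ≡ c
    d≡c j j≤n j≢z exception₀ exceptionₙ with j ℕP.<? h | j ℕP.≤? L
    ... | yes j<h | _       = d≡c-low j j<h j≢z exception₀
    ... | no  j≮h | yes j≤L = d≡c-middle j (ℕP.≮⇒≥ j≮h) j≤L j≢z
    ... | no  j≮h | no  j≰L = subst (λ i → d i ≡ c) j-h+h≡j
          (d≡c-high (j ∸ h) j-h≤L (subst (L <_) (sym j-h+h≡j) (ℕP.≰⇒> j≰L)) (subst (_≢ z) (sym j-h+h≡j) j≢z)
                (λ j-h≡L → exceptionₙ (≡.trans (sym j-h+h≡j) (cong (_+ h) j-h≡L))))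
      where
      j-h+h≡j = ℕP.m∸n+n≡m (ℕP.≮⇒≥ j≮h)
      j-h≤L : j ∸ h ≤ L
      j-h≤L = ℕP.+-cancelʳ-≤ h (j ∸ h) L (subst (_≤ n) (sym j-h+h≡j) j≤n)

    constant⇒LargeFirstStep : (∀ j → j ≤ n → d j ≡ c) → LargeFirstStep
    constant⇒LargeFirstStep const =
      (λ j _ j≤n → ≡.trans (const j j≤n) (sym (const 1 1≤n))) ,
      ℤP.≤-reflexive (≡.trans (const 1 1≤n) (sym (const 0 z≤n)))
      where 1≤n = ℕP.≤-trans 1≤h h≤n

    first-exceptional : z ≡ 0 → LargeFirstStep
    first-exceptional z≡0 =
      (λ j 1≤j j≤n → ≡.trans (flat j 1≤j j≤n) (sym (flat 1 ℕP.≤-refl 1≤n))) ,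
      subst (_≤ℤ d 0) (≡.trans (flat 2 (s≤s z≤n) (ℕP.≤-trans 2≤h h≤n)) (sym (flat 1 ℕP.≤-refl 1≤n)))
            (rise-free z≤n ℕP.≤-refl 2≤h (λ 2≡z → ℕP.1+n≢0 (≡.trans 2≡z z≡0)))
      where
      1≤n = ℕP.≤-trans 1≤h h≤n
      flat : ∀ j → 1 ≤ j → j ≤ n → d j ≡ c
      flat j 1≤j j≤n = d≡c j j≤n (λ j≡z → ℕP.<⇒≢ 1≤j (sym (≡.trans j≡z z≡0)))
                        (λ j≡0 → ⊥-elim (ℕP.<⇒≢ 1≤j (sym j≡0)))
                        (λ _ L≡z → ℕP.<⇒≢ (ℕP.≤-<-trans z≤n h<L) (sym (≡.trans L≡z z≡0)))

    last-exceptional : z ≡ n → LargeLastStep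
    last-exceptional z≡n =
      (λ j j<n → ≡.trans (flat j j<n) (sym (flat 0 0<n))) ,
      subst (_≤ℤ d n) (≡.trans (flat L L<n) (sym (flat 0 0<n)))
            (fall-free h≤n ℕP.≤-refl (2+x≤x+h L) ℕP.≤-refl (λ L≡z → ℕP.<⇒≢ L<n (≡.trans L≡z z≡n)))
      where
      0<n = ℕP.≤-<-trans z≤n L<n
      flat : ∀ j → j < n → d j ≡ c
      flat j j<n = d≡c j (ℕP.<⇒≤ j<n) (λ j≡z → ℕP.<⇒≢ j<n (≡.trans j≡z z≡n))
                    (λ _ h≡z → ℕP.<⇒≢ (ℕP.<-trans h<L L<n) (≡.trans h≡z z≡n))
                    (λ j≡n → ⊥-elim (ℕP.<⇒≢ j<n j≡n))

    beyond : n < z → ∀ j → j ≤ n → d j ≡ c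
    beyond n<z j j≤n = d≡c j j≤n (ℕP.<⇒≢ (ℕP.≤-<-trans j≤n n<z))
                         (λ _ → ℕP.<⇒≢ (ℕP.≤-<-trans h≤n n<z)) (λ _ → ℕP.<⇒≢ (ℕP.<-trans L<n n<z))

    module Interior (rise-unique : RiseUnique) (fall-unique : FallUnique) (z≢0 : z ≢ 0) (z<n : z < n) where

      c≤d[z] : c ≤ℤ d z
      c≤d[z] with z ℕP.≤? L
      ... | yes z≤L = subst (_≤ℤ d z) d[2+z]≡c (rise-free z≤L ℕP.≤-refl (2+x≤x+h z) 2+z≢z)
        where
        2+z≢z : 2 + z ≢ z
        2+z≢z e = ℕP.m≢1+n+m z (sym e)
        d[2+z]≡c : d (2 + z) ≡ c
        d[2+z]≡c = d≡c (2 + z) (ℕP.≤-trans (s≤s (s≤s z≤L)) (2+x≤x+h L)) 2+z≢z (λ ())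
                     (λ 2+z≡n L≡z → ℕP.<⇒≢ 3≤h (ℕP.+-cancelˡ-≡ L 2 h
                        (≡.trans (ℕP.+-comm L 2) (≡.trans (cong (λ x → 2 + x) L≡z) 2+z≡n))))
      ... | no z≰L = subst (_≤ℤ d z) d[w]≡c (fall-free h≤z (ℕP.<⇒≤ z<n) (ℕP.≤-reflexive 2+w≡z)
                                                        (subst (_≤ w + h) 2+w≡z (2+x≤x+h w)) w≢z)
        where
        w = z ∸ 2
        h≤z : h ≤ z
        h≤z = ℕP.<⇒≤ (ℕP.<-trans h<L (ℕP.≰⇒> z≰L))
        2+w≡z : 2 + w ≡ z
        2+w≡z = ≡.trans (ℕP.+-comm 2 w) (ℕP.m∸n+n≡m (ℕP.≤-trans 2≤h h≤z))
        w<z : w < z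
        w<z = subst (w <_) 2+w≡z (ℕP.m≤n⇒m≤1+n ℕP.≤-refl)
        w≢z : w ≢ z
        w≢z = ℕP.<⇒≢ w<z
        d[w]≡c : d w ≡ c
        d[w]≡c = d≡c w (ℕP.<⇒≤ (ℕP.<-trans w<z z<n)) w≢z
                   (λ _ h≡z → ℕP.<⇒≢ (ℕP.<-trans h<L (ℕP.≰⇒> z≰L)) h≡z)
                   (λ w≡n → ⊥-elim (ℕP.<⇒≢ (ℕP.<-trans w<z z<n) w≡n))

      d[z]≤c : d z ≤ℤ c
      d[z]≤c with suc z ℕP.≤? L
      ... | yes z<L = ℤP.≮⇒≥ λ c<d[z] →
            ℕP.<⇒≢ z′<z (ℕP.+-cancelʳ-≡ h z′ z (sym (proj₂ (fall-unique (f₁ c<d[z]) (f₂ c<d[z])))))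
        where
        z′ = pred z
        1+z′≡z : suc z′ ≡ z
        1+z′≡z = ℕP.suc-pred z {{≢-nonZero z≢0}}
        z′<z : z′ < z
        z′<z = subst (z′ <_) 1+z′≡z (ℕP.n<1+n z′)
        z≤L = ℕP.<⇒≤ z<L
        z′≤L = ℕP.<⇒≤ (ℕP.<-trans z′<z z<L)
        d[z+h]≡c : d (z + h) ≡ c
        d[z+h]≡c = d≡c (z + h) (x+h≤n z≤L) (λ e → ℕP.<⇒≢ (ℕP.m<m+n z 1≤h) (sym e))
                     (λ e → ⊥-elim (h≤j⇒j≢0 (ℕP.m≤n+m h z) e)) (λ _ L≡z → ℕP.<⇒≢ z<L (sym L≡z))
        d[z′+h]≡c : d (z′ + h) ≡ c
        d[z′+h]≡c = d≡c (z′ + h) (x+h≤n z′≤L)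
                      (λ e → ℕP.<⇒≢ (subst (λ q → suc q ≤ z′ + h) 1+z′≡z (ℕP.≤-trans (ℕP.n≤1+n _) (3+x≤x+h z′)))
                                     (sym e))
                      (λ e → ⊥-elim (h≤j⇒j≢0 (ℕP.m≤n+m h z′) e))
                      (λ e → ⊥-elim (ℕP.<⇒≢ (ℕP.<-trans z′<z z<L) (ℕP.+-cancelʳ-≡ h z′ L e)))
        f₁ : c <ℤ d z → Fall z (z + h)
        f₁ c<d[z] = ℕP.m≤n+m h z , x+h≤n z≤L , 2+x≤x+h z , ℕP.≤-refl , subst (_<ℤ d z) (sym d[z+h]≡c) c<d[z]
        f₂ : c <ℤ d z → Fall z (z′ + h)
        f₂ c<d[z] = ℕP.m≤n+m h z′ , x+h≤n z′≤L , subst (λ q → 2 + q ≤ z′ + h) 1+z′≡z (3+x≤x+h z′) ,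
                    ℕP.+-monoˡ-≤ h (ℕP.<⇒≤ z′<z) , subst (_<ℤ d z) (sym d[z′+h]≡c) c<d[z]
      ... | no z≮L = ℤP.≮⇒≥ λ c<d[z] → ℕP.1+n≢n (sym (proj₁ (rise-unique (r₁ c<d[z]) (r₂ c<d[z]))))
        where
        L≤z : L ≤ z
        L≤z = ℕP.≤-pred (ℕP.≰⇒> z≮L)
        w = z ∸ h
        w+h≡z : w + h ≡ z
        w+h≡z = ℕP.m∸n+n≡m (ℕP.≤-trans (ℕP.<⇒≤ h<L) L≤z)
        w<L : w < L
        w<L = ℕP.+-cancelʳ-< h w L (subst (_< n) (sym w+h≡z) z<n)
        d[w]≡c : d w ≡ c
        d[w]≡c = d≡c w (ℕP.≤-trans (ℕP.<⇒≤ w<L) (ℕP.<⇒≤ L<n))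
                   (ℕP.<⇒≢ (subst (w <_) w+h≡z (ℕP.m<m+n w 1≤h)))
                   (λ _ h≡z → ℕP.<⇒≢ (ℕP.<-≤-trans h<L L≤z) h≡z)
                   (λ w≡n → ⊥-elim (ℕP.<⇒≢ (ℕP.<-trans w<L L<n) w≡n))
        d[w+1]≡c : d (suc w) ≡ c
        d[w+1]≡c = d≡c (suc w) (ℕP.≤-trans w<L (ℕP.<⇒≤ L<n))
                     (ℕP.<⇒≢ (subst (suc w <_) w+h≡z (ℕP.≤-trans (ℕP.n≤1+n _) (3+x≤x+h w))))
                     (λ ())
                     (λ w+1≡n → ⊥-elim (ℕP.<⇒≢ (ℕP.≤-<-trans w<L L<n) w+1≡n))
        r₁ : c <ℤ d z → Rise w z
        r₁ c<d[z] = ℕP.<⇒≤ w<L , subst (2 + w ≤_) w+h≡z (2+x≤x+h w) , ℕP.≤-reflexive (sym w+h≡z) ,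
                    subst (_<ℤ d z) (sym d[w]≡c) c<d[z]
        r₂ : c <ℤ d z → Rise (suc w) z
        r₂ c<d[z] = w<L , subst (3 + w ≤_) w+h≡z (3+x≤x+h w) , ℕP.≤-trans (ℕP.≤-reflexive (sym w+h≡z)) (ℕP.n≤1+n _) ,
                    subst (_<ℤ d z) (sym d[w+1]≡c) c<d[z]

      d[z]≡c : d z ≡ c
      d[z]≡c = ℤP.≤-antisym d[z]≤c c≤d[z]

      d[0]≡c : d 0 ≡ c
      d[0]≡c with z ≟ h
      ... | no  z≢h = d≡c 0 z≤n (λ 0≡z → z≢0 (sym 0≡z))
                        (λ _ h≡z → z≢h (sym h≡z)) (λ 0≡n → ⊥-elim (h≤j⇒j≢0 h≤n (sym 0≡n)))
      ... | yes z≡h = ℤP.≤-antisym (subst (d 0 ≤ℤ_) (≡.trans (cong d (sym z≡h)) d[z]≡c)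
                                          (fall-free ℕP.≤-refl h≤n 2≤h ℕP.≤-refl (λ 0≡z → z≢0 (sym 0≡z))))
                                   (subst (_≤ℤ d 0) d[2]≡c (rise-free z≤n ℕP.≤-refl 2≤h 2≢z))
        where
        2≢z : 2 ≢ z
        2≢z 2≡z = ℕP.<⇒≢ 3≤h (≡.trans 2≡z z≡h)
        d[2]≡c : d 2 ≡ c
        d[2]≡c = d≡c 2 (ℕP.≤-trans 2≤h h≤n) 2≢z (λ ())
                       (λ 2≡n → ⊥-elim (ℕP.<⇒≢ (ℕP.<-≤-trans 3≤h h≤n) 2≡n))

      d[n]≡c : d n ≡ c
      d[n]≡c with z ≟ L
      ... | no  z≢L = d≡c n ℕP.≤-refl (λ n≡z → ℕP.<⇒≢ z<n (sym n≡z))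
                        (λ n≡0 → ⊥-elim (h≤j⇒j≢0 h≤n n≡0)) (λ _ L≡z → z≢L (sym L≡z))
      ... | yes z≡L = ℤP.≤-antisym (subst (d n ≤ℤ_) (≡.trans (cong d (sym z≡L)) d[z]≡c)
                                          (rise-free ℕP.≤-refl (2+x≤x+h L) ℕP.≤-refl (λ n≡z → ℕP.<⇒≢ z<n (sym n≡z))))
                                   (subst (_≤ℤ d n) d[L+1]≡c (fall-free h≤n ℕP.≤-refl (3+x≤x+h L) (ℕP.n≤1+n _) L+1≢z))
        where
        L+1≢z : suc L ≢ z
        L+1≢z e = ℕP.1+n≢n (≡.trans e z≡L)
        d[L+1]≡c : d (suc L) ≡ c
        d[L+1]≡c = d≡c (suc L) L<n L+1≢z (λ ())
                     (λ L+1≡n → ⊥-elim (ℕP.<⇒≢ 2≤h (ℕP.+-cancelˡ-≡ L 1 h (≡.trans (ℕP.+-comm L 1) L+1≡n))))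

      constant : ∀ j → j ≤ n → d j ≡ c
      constant j j≤n with j ≟ z | j ≟ 0 | j ≟ n
      ... | yes j≡z | _       | _       = ≡.trans (cong d j≡z) d[z]≡c
      ... | no  _   | yes j≡0 | _       = subst (λ i → d i ≡ c) (sym j≡0) d[0]≡c
      ... | no  _   | no  _   | yes j≡n = subst (λ i → d i ≡ c) (sym j≡n) d[n]≡c
      ... | no  j≢z | no  j≢0 | no  j≢n = d≡c j j≤n j≢z
                                              (λ j≡0 → ⊥-elim (j≢0 j≡0)) (λ j≡n → ⊥-elim (j≢n j≡n))

    shape : RiseUnique → FallUnique → LargeFirstStep ⊎ LargeLastStep
    shape rise-unique fall-unique with z ≟ 0 | z ≟ n | n ℕP.<? z
    ... | yes z≡0 | _       | _        = inj₁ (first-exceptional z≡0)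
    ... | no  _   | yes z≡n | _        = inj₂ (last-exceptional z≡n)
    ... | no  _   | no  _   | yes n<z  = inj₁ (constant⇒LargeFirstStep (beyond n<z))
    ... | no  z≢0 | no  z≢n | no  n≮z  =
          inj₁ (constant⇒LargeFirstStep
              (Interior.constant rise-unique fall-unique z≢0 (ℕP.≤∧≢⇒< (ℕP.≮⇒≥ n≮z) z≢n)))

  steps-shape : RiseUnique → FallUnique → (∀ {x y x′ y′} → Rise x y → Fall x′ y′ → y ≡ x′) →
                LargeFirstStep ⊎ LargeLastStep
  steps-shape rise-unique fall-unique rise-fall
    with exceptional-index (λ r r′ → proj₂ (rise-unique r r′)) (λ f f′ → proj₁ (fall-unique f f′)) rise-fall
  ... | z , rise⇒ , fall⇒ = Exceptional.shape z rise⇒ fall⇒ rise-unique fall-unique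

step-cases : ∀ {c u} → c ≤ u → (c ∣ u → c ≡ 1) →
             c + c < u ⊎ (c < u × u < c + c × ¬ c ∣ u) ⊎ (c ≡ 1 × (u ≡ 1 ⊎ u ≡ 2))
step-cases {c} {u} c≤u c∣u⇒c≡1 with c + c ℕP.<? u | c ∣? u
... | yes 2c<u | _       = inj₁ 2c<u
... | no  2c≮u | no  c∤u = inj₂ (inj₁ (c<u , u<2c , c∤u))
  where
  c<u : c < u
  c<u = ℕP.≤∧≢⇒< c≤u (λ c≡u → c∤u (divides 1 (≡.trans (sym c≡u) (sym (ℕP.*-identityˡ c)))))
  u<2c : u < c + c
  u<2c = ℕP.≤∧≢⇒< (ℕP.≮⇒≥ 2c≮u)
                  (λ u≡2c → c∤u (divides 2 (≡.trans u≡2c (cong (λ x → c + x) (sym (ℕP.+-identityʳ c))))))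
... | no  2c≮u | yes c∣u with u ≟ 1
...   | yes u≡1 = inj₂ (inj₂ (c∣u⇒c≡1 c∣u , inj₁ u≡1))
...   | no  u≢1 = inj₂ (inj₂ (c≡1 , inj₂ u≡2))
  where
  c≡1 = c∣u⇒c≡1 c∣u
  u≡2 : u ≡ 2
  u≡2 = ℕP.≤-antisym (subst (λ x → u ≤ x + x) c≡1 (ℕP.≮⇒≥ 2c≮u))
                     (ℕP.≤∧≢⇒< (subst (_≤ u) c≡1 c≤u) (λ 1≡u → u≢1 (sym 1≡u)))

module OneExtraSum (h L : ℕ) (3≤h : 3 ≤ h) (2h≤L+1 : h + h ≤ suc L)
                   (a : ℕ → ℤ) (a-inc : ∀ i → i ≤ L + h → a i <ℤ a (suc i))
                   (sums : List ℤ) (sums-unique : Unique sums) (|sums| : length sums ≡ 2 + (2 + L) * h)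
                   (omit-∈ : ∀ t m → t ≤ suc L → t ≤ m → m ≤ t + h → sumRange a t (suc h) -ℤ a m ∈ sums)
                   (omit₂-∈ : ∀ i p q → i ≤ L → i ≤ p → p < q → q ≤ i + suc h →
                              sumRange a i (suc (suc h)) -ℤ a p -ℤ a q ∈ sums)
  where

  open Chain h L a a-inc

  chain⊆sums : ∀ {x} → x ∈ chain → x ∈ sums
  chain⊆sums p with ∈-chain p
  ... | inj₁ (t , m , t≤ , t<m , m≤ , ≡.refl) = omit-∈ t m t≤ (ℕP.<⇒≤ t<m) m≤
  ... | inj₂ ≡.refl = subst (_∈ sums) (omit-first (suc L)) (omit-∈ (suc L) (suc L) ℕP.≤-refl ℕP.≤-refl (ℕP.m≤m+n _ h))

  -- The chain already accounts for all but one of the 2 + (2 + L) h elements of sums.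
  outside-chain-unique : ∀ {e₁ e₂} → e₁ ∈ sums → e₂ ∈ sums → e₁ ∉ chain → e₂ ∉ chain → e₁ ≡ e₂
  outside-chain-unique {e₁} {e₂} e₁∈ e₂∈ e₁∉ e₂∉ with e₁ ℤ.≟ e₂
  ... | yes e₁≡e₂ = e₁≡e₂
  ... | no  e₁≢e₂ = ⊥-elim (ℕP.<-irrefl ≡.refl (ℕP.≤-trans too-long (ℕP.≤-reflexive |sums|)))
    where
    extended : List ℤ
    extended = chain ++ e₁ ∷ e₂ ∷ []
    extended-unique : Unique extended
    extended-unique = AllPairsₚ.++⁺ chain-unique ((e₁≢e₂ ∷ []) ∷ [] ∷ [])
      (All.tabulate (λ x∈ → (λ x≡e₁ → e₁∉ (subst (_∈ chain) x≡e₁ x∈))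
                             ∷ (λ x≡e₂ → e₂∉ (subst (_∈ chain) x≡e₂ x∈)) ∷ []))
    extended⊆sums : ∀ {x} → x ∈ extended → x ∈ sums
    extended⊆sums p with ∈-++⁻ chain p
    ... | inj₁ q                    = chain⊆sums q
    ... | inj₂ (here ≡.refl)        = e₁∈
    ... | inj₂ (there (here ≡.refl)) = e₂∈
    too-long : 3 + (2 + L) * h ≤ length sums
    too-long = subst (_≤ length sums) (≡.trans (length-++ chain) (≡.trans (cong (_+ 2) chain-length) (ℕP.+-comm _ 2)))
                     (Unique⇒length≤ extended-unique extended⊆sums)

  gaps-coincide : ∀ {t₁ m₁ e₁ t₂ m₂ e₂} → e₁ ∈ sums × InGap t₁ m₁ e₁ → e₂ ∈ sums × InGap t₂ m₂ e₂ →
                  t₁ ≡ t₂ × m₁ ≡ m₂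
  gaps-coincide (e₁∈ , g₁) (e₂∈ , g₂) =
    InGap-injective g₁ (subst (InGap _ _)
                        (sym (outside-chain-unique e₁∈ e₂∈ (InGap⇒∉chain g₁) (InGap⇒∉chain g₂))) g₂)

  omit₂ : ℕ → ℕ → ℕ → ℤ
  omit₂ i p q = sumRange a i (suc (suc h)) -ℤ a p -ℤ a q

  omit₂-next-block : ∀ i p q → omit₂ i p q ≡ blockSum (suc i) -ℤ ((a p +ℤ a q) -ℤ a i)
  omit₂-next-block i p q = rearrange (a i) (sumRange a (suc i) (suc h)) (a p) (a q)
    where
    rearrange : ∀ x F y z → (x +ℤ F) -ℤ y -ℤ z ≡ F -ℤ ((y +ℤ z) -ℤ x)
    rearrange = solve-∀

  omit₂-same-block : ∀ i p q → omit₂ i p q ≡ blockSum i -ℤ ((a p +ℤ a q) -ℤ a (suc (i + h)))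
  omit₂-same-block i p q = begin
    sumRange a i (suc (suc h)) -ℤ a p -ℤ a q
      ≡⟨ cong (λ s → s -ℤ a p -ℤ a q) (sumRange-snoc a i (suc h)) ⟩
    (sumRange a i (suc h) +ℤ a (i + suc h)) -ℤ a p -ℤ a q
      ≡⟨ rearrange (sumRange a i (suc h)) (a (i + suc h)) (a p) (a q) ⟩
    sumRange a i (suc h) -ℤ ((a p +ℤ a q) -ℤ a (i + suc h))
      ≡⟨ cong (λ j → sumRange a i (suc h) -ℤ ((a p +ℤ a q) -ℤ a j)) (ℕP.+-suc i h) ⟩
    sumRange a i (suc h) -ℤ ((a p +ℤ a q) -ℤ a (suc (i + h))) ∎
    where
    open ≡.≡-Reasoning
    rearrange : ∀ F x y z → (F +ℤ x) -ℤ y -ℤ z ≡ F -ℤ ((y +ℤ z) -ℤ x)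
    rearrange = solve-∀

  d : ℕ → ℤ
  d j = a (suc j) -ℤ a j

  a-suc : ∀ j → a (suc j) ≡ a j +ℤ d j
  a-suc j = x≡y+[x-y] (a (suc j)) (a j)
    where
    x≡y+[x-y] : ∀ x y → x ≡ y +ℤ (x -ℤ y)
    x≡y+[x-y] = solve-∀

  0<d : ∀ {j} → j ≤ L + h → 0ℤ <ℤ d j
  0<d {j} j≤ = subst (_<ℤ d j) (ℤP.+-inverseʳ (a j)) (ℤP.+-monoˡ-< (- a j) (a-inc j j≤))

  open Steps h L 3≤h 2h≤L+1 d

  rise-sum : ∀ {x y} → Rise x y → omit₂ x (suc x) y ∈ sums × InGap (suc x) y (omit₂ x (suc x) y)
  rise-sum {x} {y} (x≤L , 2+x≤y , y≤x+h , dx<dy) =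
    omit₂-∈ x (suc x) y x≤L (ℕP.n≤1+n x) 2+x≤y (ℕP.≤-trans y≤x+h (ℕP.+-monoʳ-≤ x (ℕP.n≤1+n h))) ,
    subst (InGap (suc x) y) (sym (omit₂-next-block x (suc x) y))
      (InGap-below (s≤s x≤L) (ℕP.<⇒≤ 2+x≤y) (s≤s y≤x+h)
        (subst (a y <ℤ_) (sym r≡) (x<x+p (a y) (0<d (ℕP.≤-trans x≤L (ℕP.m≤m+n L h)))))
        (subst₂ _<ℤ_ (sym r≡) (sym (a-suc y)) (ℤP.+-monoʳ-< (a y) dx<dy)))
    where
    r≡ : (a (suc x) +ℤ a y) -ℤ a x ≡ a y +ℤ d x
    r≡ = rearrange (a (suc x)) (a y) (a x)
      where
      rearrange : ∀ u v w → (u +ℤ v) -ℤ w ≡ v +ℤ (u -ℤ w)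
      rearrange = solve-∀

  fall-sum : ∀ {x y} → Fall x y → omit₂ (y ∸ h) (suc x) y ∈ sums × InGap (y ∸ h) x (omit₂ (y ∸ h) (suc x) y)
  fall-sum {x} {y} (h≤y , y≤n , 2+x≤y , y≤x+h , dy<dx) =
    omit₂-∈ i (suc x) y i≤L (ℕP.m≤n⇒m≤1+n i≤x) 2+x≤y
            (subst (y ≤_) (sym (≡.trans (ℕP.+-suc i h) (cong suc i+h≡y))) (ℕP.n≤1+n y)) ,
    subst (InGap i x) (sym (omit₂-same-block i (suc x) y))
      (InGap-below (ℕP.m≤n⇒m≤1+n i≤L) i≤x x<i+h
        (subst (a x <ℤ_) (sym r≡₁) (x<x+p (a x) (subst (_<ℤ d x -ℤ d y) (ℤP.+-inverseʳ (d y)) (ℤP.+-monoˡ-< (- d y) dy<dx))))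
        (subst (_<ℤ a (suc x)) (sym r≡₂) (x-p<x (a (suc x)) (0<d y≤n))))
    where
    i = y ∸ h
    i+h≡y : i + h ≡ y
    i+h≡y = ℕP.m∸n+n≡m h≤y
    i≤L : i ≤ L
    i≤L = ℕP.+-cancelʳ-≤ h i L (subst (_≤ L + h) (sym i+h≡y) y≤n)
    i≤x : i ≤ x
    i≤x = ℕP.+-cancelʳ-≤ h i x (subst (_≤ x + h) (sym i+h≡y) y≤x+h)
    x<i+h : x < i + h
    x<i+h = subst (x <_) (sym i+h≡y) (ℕP.≤-trans (ℕP.n≤1+n _) 2+x≤y)
    r = (a (suc x) +ℤ a y) -ℤ a (suc (i + h))
    a[i+h+1]≡ : a (suc (i + h)) ≡ a y +ℤ d y
    a[i+h+1]≡ = ≡.trans (cong (λ j → a (suc j)) i+h≡y) (a-suc y)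
    r≡₁ : r ≡ a x +ℤ (d x -ℤ d y)
    r≡₁ = ≡.trans (cong (λ s → (a (suc x) +ℤ a y) -ℤ s) a[i+h+1]≡) (rearrange (a (suc x)) (a x) (a y) (a (suc y)))
      where
      rearrange : ∀ u v w z → (u +ℤ w) -ℤ (w +ℤ (z -ℤ w)) ≡ v +ℤ ((u -ℤ v) -ℤ (z -ℤ w))
      rearrange = solve-∀
    r≡₂ : r ≡ a (suc x) -ℤ d y
    r≡₂ = ≡.trans (cong (λ s → (a (suc x) +ℤ a y) -ℤ s) a[i+h+1]≡) (rearrange (a (suc x)) (a y) (a (suc y)))
      where
      rearrange : ∀ u w z → (u +ℤ w) -ℤ (w +ℤ (z -ℤ w)) ≡ u -ℤ (z -ℤ w)
      rearrange = solve-∀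

  step-structure : LargeFirstStep ⊎ LargeLastStep
  step-structure = steps-shape rise-unique fall-unique rise-fall
    where
    rise-unique : RiseUnique
    rise-unique r r′ = ℕP.suc-injective (proj₁ same) , proj₂ same
      where same = gaps-coincide (rise-sum r) (rise-sum r′)
    fall-unique : FallUnique
    fall-unique f@(h≤y , _) f′@(h≤y′ , _) =
      proj₂ same , ≡.trans (sym (ℕP.m∸n+n≡m h≤y)) (≡.trans (cong (_+ h) (proj₁ same)) (ℕP.m∸n+n≡m h≤y′))
      where same = gaps-coincide (fall-sum f) (fall-sum f′)
    rise-fall : ∀ {x y x′ y′} → Rise x y → Fall x′ y′ → y ≡ x′
    rise-fall r f = proj₂ (gaps-coincide (rise-sum r) (fall-sum f))

  omit₂-< : ∀ i {p q p′ q′} → a p′ +ℤ a q′ <ℤ a p +ℤ a q → omit₂ i p q <ℤ omit₂ i p′ q′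
  omit₂-< i {p} {q} {p′} {q′} lt = subst₂ _<ℤ_ (rearrange F (a p) (a q)) (rearrange F (a p′) (a q′))
                                    (ℤP.+-monoʳ-< F (ℤP.neg-mono-< lt))
    where
    F = sumRange a i (suc (suc h))
    rearrange : ∀ F x y → F -ℤ (x +ℤ y) ≡ F -ℤ x -ℤ y
    rearrange = solve-∀

  omit₂-InGap-same : ∀ {i p q m} → i ≤ L → i ≤ m → m < i + h →
                     a m +ℤ a (suc (i + h)) <ℤ a p +ℤ a q → a p +ℤ a q <ℤ a (suc m) +ℤ a (suc (i + h)) →
                     InGap i m (omit₂ i p q)
  omit₂-InGap-same {i} {p} {q} {m} i≤L i≤m m< lo hi =
    subst (InGap i m) (sym (omit₂-same-block i p q)) (InGap-below (ℕP.m≤n⇒m≤1+n i≤L) i≤m m< (x<s-y lo) (s-y<x hi))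

  omit₂-InGap-next : ∀ {i p q m} → i ≤ L → suc i ≤ m → m < suc i + h →
                     a m +ℤ a i <ℤ a p +ℤ a q → a p +ℤ a q <ℤ a (suc m) +ℤ a i →
                     InGap (suc i) m (omit₂ i p q)
  omit₂-InGap-next {i} {p} {q} {m} i≤L i<m m< lo hi =
    subst (InGap (suc i) m) (sym (omit₂-next-block i p q)) (InGap-below (s≤s i≤L) i<m m< (x<s-y lo) (s-y<x hi))

  omit₂-∉chain-same : ∀ {i p q} → i ≤ L →
                      a i +ℤ a (suc (i + h)) <ℤ a p +ℤ a q → a p +ℤ a q <ℤ a (i + h) +ℤ a (suc (i + h)) →
                      (∀ m → i < m → m ≤ i + h → a m +ℤ a (suc (i + h)) ≢ a p +ℤ a q) → omit₂ i p q ∉ chain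
  omit₂-∉chain-same {i} {p} {q} i≤L lo hi ≢ =
    subst (_∉ chain) (sym (omit₂-same-block i p q))
      (∉chain-below (ℕP.m≤n⇒m≤1+n i≤L) (x<s-y lo) (s-y<x hi) (λ m i<m m≤ → s-y≢x (≢ m i<m m≤)))

  omit₂-∉chain-next : ∀ {i p q} → i ≤ L →
                      a (suc i) +ℤ a i <ℤ a p +ℤ a q → a p +ℤ a q <ℤ a (suc i + h) +ℤ a i →
                      (∀ m → suc i < m → m ≤ suc i + h → a m +ℤ a i ≢ a p +ℤ a q) → omit₂ i p q ∉ chain
  omit₂-∉chain-next {i} {p} {q} i≤L lo hi ≢ =
    subst (_∉ chain) (sym (omit₂-next-block i p q))
      (∉chain-below (s≤s i≤L) (x<s-y lo) (s-y<x hi) (λ m i<m m≤ → s-y≢x (≢ m i<m m≤)))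

  compare-sums : ∀ {p q r s w x y z} → a p ≡ + w → a q ≡ + x → a r ≡ + y → a s ≡ + z →
                 w + x < y + z → a p +ℤ a q <ℤ a r +ℤ a s
  compare-sums {w = w} {x} {y} {z} ap aq ar as lt =
    subst₂ _<ℤ_ (≡.trans (ℤP.pos-+ w x) (sym (≡.cong₂ _+ℤ_ ap aq)))
                (≡.trans (ℤP.pos-+ y z) (sym (≡.cong₂ _+ℤ_ ar as))) (ℤ.+<+ lt)

  equal-sums : ∀ {p q r s w x y z} → a p ≡ + w → a q ≡ + x → a r ≡ + y → a s ≡ + z →
               a p +ℤ a q ≡ a r +ℤ a s → w + x ≡ y + z
  equal-sums {w = w} {x} {y} {z} ap aq ar as eq =
    ℤP.+-injective (≡.trans (ℤP.pos-+ w x) (≡.trans (sym (≡.cong₂ _+ℤ_ ap aq))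
                                                 (≡.trans eq (≡.trans (≡.cong₂ _+ℤ_ ar as) (sym (ℤP.pos-+ y z))))))

  module Normalised (a₀≡0 : a 0 ≡ 0ℤ)
                    (coprime : ∀ g → (∀ i → i ≤ K → g ∣ ℤ.∣ a i ∣) → g ≡ 1)
                    (sums-bounded : ∀ {s} → s ∈ sums → window 0 ≤ℤ s × s ≤ℤ window (2 + L))
    where

    GapAfterFirst : Set
    GapAfterFirst = ∀ i → 1 ≤ i → i ≤ K → a i ≡ + suc i

    GapBeforeLast : Set
    GapBeforeLast = (∀ i → i < K → a i ≡ + i) × a K ≡ + suc K

    not-progression : ¬ (∀ i → i ≤ K → a i ≡ + i)
    not-progression a≡i = ℕP.<-irrefl ≡.refl
      (ℕP.≤-trans (ℕP.≤-reflexive (sym |sums|)) (Unique-bounded-length (window 0) ((2 + L) * h) sums-unique bounded))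
      where
      step : ∀ t → t ≤ suc L → a (t + h) -ℤ a t ≡ + h
      step t t≤ = ≡.trans (≡.cong₂ _-ℤ_ (≡.trans (a≡i (t + h) (+h≤K t≤)) (ℤP.pos-+ t h))
                                         (a≡i t (ℕP.≤-trans (ℕP.m≤m+n t h) (+h≤K t≤))))
                          ([x+y]-x≡y (+ t) (+ h))
      window≡ : ∀ t → t ≤ 2 + L → window t ≡ window 0 +ℤ + (t * h)
      window≡ zero    _  = sym (ℤP.+-identityʳ (window 0))
      window≡ (suc t) t< = begin
        window (suc t)                          ≡⟨ window-suc t ⟩
        window t +ℤ (a (t + h) -ℤ a t)          ≡⟨ ≡.cong₂ _+ℤ_ (window≡ t (ℕP.<⇒≤ t<)) (step t (ℕP.≤-pred t<)) ⟩
        (window 0 +ℤ + (t * h)) +ℤ + h          ≡⟨ ℤP.+-assoc (window 0) _ _ ⟩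
        window 0 +ℤ (+ (t * h) +ℤ + h)          ≡⟨ cong (window 0 +ℤ_) (sym (ℤP.pos-+ (t * h) h)) ⟩
        window 0 +ℤ + (t * h + h)               ≡⟨ cong (λ j → window 0 +ℤ + j) (ℕP.+-comm (t * h) h) ⟩
        window 0 +ℤ + (suc t * h)               ∎
        where open ≡.≡-Reasoning
      bounded : ∀ {s} → s ∈ sums → window 0 ≤ℤ s × s ≤ℤ window 0 +ℤ + ((2 + L) * h)
      bounded s∈ = proj₁ (sums-bounded s∈) , subst (_ ≤ℤ_) (window≡ (2 + L) ℕP.≤-refl) (proj₂ (sums-bounded s∈))

    h₂ : ℕ
    h₂ = h ∸ 2

    h≡2+h₂ : h ≡ 2 + h₂
    h≡2+h₂ = ≡.trans (sym (ℕP.m∸n+n≡m 2≤h)) (ℕP.+-comm h₂ 2)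

    1≤h₂ : 1 ≤ h₂
    1≤h₂ = ℕP.≤-pred (ℕP.≤-pred (subst (3 ≤_) h≡2+h₂ 3≤h))

    2*c≤[1+h₂]*c : ∀ c → c + c ≤ (1 + h₂) * c
    2*c≤[1+h₂]*c c = subst (_≤ (1 + h₂) * c) (cong (λ x → c + x) (ℕP.+-identityʳ c)) (ℕP.*-monoˡ-≤ c (s≤s 1≤h₂))

    module LargeFirst (steps : LargeFirstStep) where

      c u : ℕ
      c = ℤ.∣ d 1 ∣
      u = ℤ.∣ d 0 ∣

      +c≡d₁ : + c ≡ d 1
      +c≡d₁ = ℤP.0≤i⇒+∣i∣≡i (ℤP.<⇒≤ (0<d (ℕP.≤-trans 1≤h (ℕP.m≤n+m h L))))

      +u≡d₀ : + u ≡ d 0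
      +u≡d₀ = ℤP.0≤i⇒+∣i∣≡i (ℤP.<⇒≤ (0<d z≤n))

      c≤u : c ≤ u
      c≤u = ℤP.drop‿+≤+ (subst₂ _≤ℤ_ (sym +c≡d₁) (sym +u≡d₀) (proj₂ steps))

      a-closed : ∀ j → j ≤ L + h → a (suc j) ≡ + (u + j * c)
      a-closed zero    _  = ≡.trans (a-suc 0) (≡.trans (≡.cong₂ _+ℤ_ a₀≡0 (sym +u≡d₀))
                                               (cong +_ (sym (ℕP.+-identityʳ u))))
      a-closed (suc j) j< = ≡.trans (a-suc (suc j)) (≡.trans (≡.cong₂ _+ℤ_ (a-closed j (ℕP.<⇒≤ j<)) d≡c)
                                               (cong +_ (add-step u j c)))
        where
        d≡c : d (suc j) ≡ + c
        d≡c = ≡.trans (proj₁ steps (suc j) (s≤s z≤n) j<) (sym +c≡d₁)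
        add-step : ∀ u j c → u + j * c + c ≡ u + suc j * c
        add-step = solveℕ-∀

      2+h₂≤n : 2 + h₂ ≤ L + h
      2+h₂≤n = ℕP.≤-trans (ℕP.≤-reflexive (sym h≡2+h₂)) h≤n

      a₁ : a 1 ≡ + u
      a₁ = ≡.trans (a-closed 0 z≤n) (cong +_ (ℕP.+-identityʳ u))

      a₂ : a 2 ≡ + (u + c)
      a₂ = ≡.trans (a-closed 1 (ℕP.≤-trans 1≤h h≤n)) (cong (λ x → + (u + x)) (ℕP.+-identityʳ c))

      a[h-1] : a (1 + h₂) ≡ + (u + h₂ * c)
      a[h-1] = a-closed h₂ (ℕP.≤-trans (ℕP.≤-trans (ℕP.n≤1+n h₂) (ℕP.n≤1+n _)) 2+h₂≤n)

      a[h] : a h ≡ + (u + (1 + h₂) * c)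
      a[h] = ≡.trans (cong a h≡2+h₂) (a-closed (1 + h₂) (ℕP.≤-trans (ℕP.n≤1+n _) 2+h₂≤n))

      a[h+1] : a (suc h) ≡ + (u + (2 + h₂) * c)
      a[h+1] = ≡.trans (cong (λ j → a (suc j)) h≡2+h₂) (a-closed (2 + h₂) 2+h₂≤n)

      e₁∈sums : omit₂ 0 1 h ∈ sums
      e₁∈sums = omit₂-∈ 0 1 h z≤n z≤n 2≤h (ℕP.n≤1+n h)

      e₁-in-gap : c < u → InGap 0 0 (omit₂ 0 1 h)
      e₁-in-gap c<u = omit₂-InGap-same z≤n z≤n 1≤h
        (compare-sums a₀≡0 a[h+1] a₁ a[h]
          (subst₂ _<_ (rearrange₁ u c h₂) (rearrange₂ u c h₂) (ℕP.+-monoʳ-< (u + (1 + h₂) * c) c<u)))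
        (ℤP.+-monoʳ-< (a 1) (a-inc h h≤n))
        where
        rearrange₁ : ∀ u c h₂ → u + (1 + h₂) * c + c ≡ 0 + (u + (2 + h₂) * c)
        rearrange₁ = solveℕ-∀
        rearrange₂ : ∀ u c h₂ → u + (1 + h₂) * c + u ≡ u + (u + (1 + h₂) * c)
        rearrange₂ = solveℕ-∀

      e₁<omit₂ : ∀ {q} → 1 < q → q < h → omit₂ 0 1 h <ℤ omit₂ 0 1 q
      e₁<omit₂ 1<q q<h = omit₂-< 0 (ℤP.+-monoʳ-< (a 1) (a-< q<h h≤K))
        where h≤K = ℕP.≤-trans h≤n (ℕP.n≤1+n _)

      not-above-2c : ¬ (c + c < u)
      not-above-2c 2c<u = ℤP.<⇒≢ (e₁<omit₂ (s≤s 1≤h₂) (subst (1 + h₂ <_) (sym h≡2+h₂) ℕP.≤-refl))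
                        (outside-chain-unique e₁∈sums e₂∈sums (InGap⇒∉chain (e₁-in-gap c<u)) (InGap⇒∉chain e₂-in-gap))
        where
        c<u : c < u
        c<u = ℕP.≤-<-trans (ℕP.m≤m+n c c) 2c<u
        e₂∈sums : omit₂ 0 1 (1 + h₂) ∈ sums
        e₂∈sums = omit₂-∈ 0 1 (1 + h₂) z≤n z≤n (s≤s 1≤h₂)
                    (subst (1 + h₂ ≤_) (cong suc (sym h≡2+h₂)) (ℕP.≤-trans (ℕP.n≤1+n (1 + h₂)) (ℕP.n≤1+n (2 + h₂))))
        e₂-in-gap : InGap 0 0 (omit₂ 0 1 (1 + h₂))
        e₂-in-gap = omit₂-InGap-same z≤n z≤n 1≤h
          (compare-sums a₀≡0 a[h+1] a₁ a[h-1]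
            (subst₂ _<_ (rearrange₁ u c h₂) (rearrange₂ u c h₂) (ℕP.+-monoʳ-< (u + h₂ * c) 2c<u)))
          (ℤP.+-monoʳ-< (a 1) (a-< (subst (1 + h₂ <_) (cong suc (sym h≡2+h₂)) (ℕP.n≤1+n (2 + h₂))) (s≤s h≤n)))
          where
          rearrange₁ : ∀ u c h₂ → u + h₂ * c + (c + c) ≡ 0 + (u + (2 + h₂) * c)
          rearrange₁ = solveℕ-∀
          rearrange₂ : ∀ u c h₂ → u + h₂ * c + u ≡ u + (u + h₂ * c)
          rearrange₂ = solveℕ-∀

      between⇒c∣u : c < u → u < c + c → c ∣ u
      between⇒c∣u c<u u<2c with c ∣? u
      ... | yes c∣u = c∣u
      ... | no  c∤u = ⊥-elim (ℤP.<⇒≢ (e₁<omit₂ ℕP.≤-refl 3≤h)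
                        (outside-chain-unique e₁∈sums e₃∈sums (InGap⇒∉chain (e₁-in-gap c<u)) e₃∉chain))
        where
        e₃∈sums : omit₂ 0 1 2 ∈ sums
        e₃∈sums = omit₂-∈ 0 1 2 z≤n z≤n ℕP.≤-refl (ℕP.≤-trans 2≤h (ℕP.n≤1+n h))
        e₃∉chain : omit₂ 0 1 2 ∉ chain
        e₃∉chain = omit₂-∉chain-next z≤n
          (ℤP.+-monoʳ-< (a 1) (a-< (s≤s z≤n) (ℕP.≤-trans 2≤h (ℕP.≤-trans h≤n (ℕP.n≤1+n _)))))
          (compare-sums a₁ a₂ a[h+1] a₀≡0 (subst₂ _<_ (rearrange₁ u c) (rearrange₂ u c h₂)
            (ℕP.+-monoʳ-< (u + c) (ℕP.<-≤-trans u<2c (2*c≤[1+h₂]*c c)))))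
          ≢a₁+a₂
          where
          rearrange₁ : ∀ u c → u + c + u ≡ u + (u + c)
          rearrange₁ = solveℕ-∀
          rearrange₂ : ∀ u c h₂ → u + c + (1 + h₂) * c ≡ u + (2 + h₂) * c + 0
          rearrange₂ = solveℕ-∀
          ≢a₁+a₂ : ∀ m → 1 < m → m ≤ 1 + h → a m +ℤ a 0 ≢ a 1 +ℤ a 2
          ≢a₁+a₂ (suc zero)    (s≤s ()) _
          ≢a₁+a₂ (suc (suc m)) _ m≤ eq = c∤u (divides m (sym (ℕP.+-cancelˡ-≡ (u + c) _ _
                                                          (≡.trans (rearrange₃ u c m) (≡.trans sums≡ (rearrange₄ u c))))))
            where
            sums≡ : u + suc m * c + 0 ≡ u + (u + c)
            sums≡ = equal-sums (a-closed (suc m) (ℕP.≤-trans (ℕP.≤-pred m≤) h≤n)) a₀≡0 a₁ a₂ eq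
            rearrange₃ : ∀ u c m → u + c + m * c ≡ u + suc m * c + 0
            rearrange₃ = solveℕ-∀
            rearrange₄ : ∀ u c → u + (u + c) ≡ u + c + u
            rearrange₄ = solveℕ-∀

      c∣u⇒c≡1 : c ∣ u → c ≡ 1
      c∣u⇒c≡1 c∣u = coprime c c∣a
        where
        c∣a : ∀ i → i ≤ K → c ∣ ℤ.∣ a i ∣
        c∣a zero    _  = subst (λ x → c ∣ ℤ.∣ x ∣) (sym a₀≡0) (divides 0 ≡.refl)
        c∣a (suc j) j< = subst (λ x → c ∣ ℤ.∣ x ∣) (sym (a-closed j (ℕP.≤-pred j<))) (∣m∣n⇒∣m+n c∣u (n∣m*n j))

      a-unit : c ≡ 1 → ∀ j → j ≤ L + h → a (suc j) ≡ + (u + j)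
      a-unit c≡1 j j≤ = ≡.trans (a-closed j j≤) (cong (λ x → + (u + x)) (≡.trans (cong (j *_) c≡1) (ℕP.*-identityʳ j)))

      gap-after-first : GapAfterFirst
      gap-after-first with step-cases c≤u c∣u⇒c≡1
      ... | inj₁ 2c<u                      = ⊥-elim (not-above-2c 2c<u)
      ... | inj₂ (inj₁ (c<u , u<2c , c∤u)) = ⊥-elim (c∤u (between⇒c∣u c<u u<2c))
      ... | inj₂ (inj₂ (c≡1 , inj₁ u≡1))   = ⊥-elim (not-progression a≡i)
        where
        a≡i : ∀ i → i ≤ K → a i ≡ + i
        a≡i zero    _  = a₀≡0
        a≡i (suc j) j< = ≡.trans (a-unit c≡1 j (ℕP.≤-pred j<)) (cong (λ x → + (x + j)) u≡1)
      ... | inj₂ (inj₂ (c≡1 , inj₂ u≡2))   =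
        λ { (suc j) _ j< → ≡.trans (a-unit c≡1 j (ℕP.≤-pred j<)) (cong (λ x → + (x + j)) u≡2) }

    module LargeLast (steps : LargeLastStep) where

      c u : ℕ
      c = ℤ.∣ d 0 ∣
      u = ℤ.∣ d n ∣

      +c≡d₀ : + c ≡ d 0
      +c≡d₀ = ℤP.0≤i⇒+∣i∣≡i (ℤP.<⇒≤ (0<d z≤n))

      +u≡dₙ : + u ≡ d n
      +u≡dₙ = ℤP.0≤i⇒+∣i∣≡i (ℤP.<⇒≤ (0<d ℕP.≤-refl))

      c≤u : c ≤ u
      c≤u = ℤP.drop‿+≤+ (subst₂ _≤ℤ_ (sym +c≡d₀) (sym +u≡dₙ) (proj₂ steps))

      d≡c : ∀ {j} → j < n → d j ≡ + c
      d≡c j<n = ≡.trans (proj₁ steps _ j<n) (sym +c≡d₀)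

      a-closed : ∀ j → j ≤ n → a j ≡ + (j * c)
      a-closed zero    _  = a₀≡0
      a-closed (suc j) j< = ≡.trans (a-suc j) (≡.trans (≡.cong₂ _+ℤ_ (a-closed j (ℕP.<⇒≤ j<)) (d≡c j<))
                                               (cong +_ (ℕP.+-comm (j * c) c)))

      a-last : a K ≡ + (n * c + u)
      a-last = ≡.trans (a-suc n) (≡.cong₂ _+ℤ_ (a-closed n ℕP.≤-refl) (sym +u≡dₙ))

      L+h₁<n : L + (1 + h₂) < n
      L+h₁<n = subst (λ x → L + (1 + h₂) < L + x) (sym h≡2+h₂) (ℕP.+-monoʳ-< L (ℕP.n<1+n (1 + h₂)))

      n≤L+1+h : n ≤ L + suc h
      n≤L+1+h = ℕP.≤-trans (ℕP.n≤1+n n) (ℕP.≤-reflexive (sym (ℕP.+-suc L h)))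

      e₁ : c < u → omit₂ L (suc L) n ∈ sums × InGap (suc L) n (omit₂ L (suc L) n)
      e₁ c<u = rise-sum (ℕP.≤-refl , 2+x≤x+h L , ℕP.≤-refl , subst₂ _<ℤ_ (sym (d≡c L<n)) +u≡dₙ (ℤ.+<+ c<u))

      omit₂<e₁ : ∀ {p} → suc L < p → p < n → omit₂ L p n <ℤ omit₂ L (suc L) n
      omit₂<e₁ L+1<p p<n = omit₂-< L (ℤP.+-monoˡ-< (a n) (a-< L+1<p (ℕP.<⇒≤ (ℕP.<-trans p<n (ℕP.n<1+n n)))))

      not-above-2c : ¬ (c + c < u)
      not-above-2c 2c<u = ℤP.<⇒≢ (omit₂<e₁ ℕP.≤-refl (3+x≤x+h L))
                        (outside-chain-unique e₂∈sums (proj₁ (e₁ c<u))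
                                       (InGap⇒∉chain e₂-in-gap) (InGap⇒∉chain (proj₂ (e₁ c<u))))
        where
        c<u : c < u
        c<u = ℕP.≤-<-trans (ℕP.m≤m+n c c) 2c<u
        e₂∈sums : omit₂ L (2 + L) n ∈ sums
        e₂∈sums = omit₂-∈ L (2 + L) n ℕP.≤-refl (ℕP.≤-trans (ℕP.n≤1+n L) (ℕP.n≤1+n _)) (3+x≤x+h L) n≤L+1+h
        e₂-in-gap : InGap (suc L) n (omit₂ L (2 + L) n)
        e₂-in-gap = omit₂-InGap-next ℕP.≤-refl L<n ℕP.≤-refl
          (subst (_<ℤ a (2 + L) +ℤ a n) (ℤP.+-comm (a L) (a n))
            (ℤP.+-monoˡ-< (a n) (a-< (ℕP.n≤1+n (suc L)) (ℕP.≤-trans (2+x≤x+h L) (ℕP.n≤1+n n)))))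
          (compare-sums (a-closed (2 + L) (ℕP.≤-trans (ℕP.n≤1+n _) (3+x≤x+h L))) (a-closed n ℕP.≤-refl)
            a-last (a-closed L (ℕP.<⇒≤ L<n))
            (subst₂ _<_ (rearrange₁ n c L) (rearrange₂ n c L u) (ℕP.+-monoʳ-< (n * c + L * c) 2c<u)))
          where
          rearrange₁ : ∀ n c L → n * c + L * c + (c + c) ≡ (2 + L) * c + n * c
          rearrange₁ = solveℕ-∀
          rearrange₂ : ∀ n c L u → n * c + L * c + u ≡ n * c + u + L * c
          rearrange₂ = solveℕ-∀

      between⇒c∣u : c < u → u < c + c → c ∣ u
      between⇒c∣u c<u u<2c with c ∣? u
      ... | yes c∣u = c∣u
      ... | no  c∤u = ⊥-elim (ℤP.<⇒≢ (omit₂<e₁ (subst (_< L + (1 + h₂)) (ℕP.+-comm L 1) (ℕP.+-monoʳ-< L (s≤s 1≤h₂)))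
                                             L+h₁<n)
                        (outside-chain-unique e₃∈sums (proj₁ (e₁ c<u)) e₃∉chain (InGap⇒∉chain (proj₂ (e₁ c<u)))))
        where
        a[L+h₁] : a (L + (1 + h₂)) ≡ + ((L + (1 + h₂)) * c)
        a[L+h₁] = a-closed (L + (1 + h₂)) (ℕP.<⇒≤ L+h₁<n)
        e₃∈sums : omit₂ L (L + (1 + h₂)) n ∈ sums
        e₃∈sums = omit₂-∈ L (L + (1 + h₂)) n ℕP.≤-refl (ℕP.m≤m+n L _) L+h₁<n n≤L+1+h
        e₃∉chain : omit₂ L (L + (1 + h₂)) n ∉ chain
        e₃∉chain = omit₂-∉chain-same ℕP.≤-refl
          (compare-sums (a-closed L (ℕP.<⇒≤ L<n)) a-last a[L+h₁] (a-closed n ℕP.≤-refl)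
            (subst₂ _<_ (rearrange₁ L c n u) (rearrange₂ L c n h₂)
              (ℕP.+-monoʳ-< (L * c + n * c) (ℕP.<-≤-trans u<2c (2*c≤[1+h₂]*c c)))))
          (subst (_<ℤ a n +ℤ a K) (ℤP.+-comm (a n) _)
            (ℤP.+-monoʳ-< (a n) (a-< (ℕP.<-trans L+h₁<n (ℕP.n<1+n n)) ℕP.≤-refl)))
          ≢a[L+h₁]+aₙ
          where
          rearrange₁ : ∀ L c n u → L * c + n * c + u ≡ L * c + (n * c + u)
          rearrange₁ = solveℕ-∀
          rearrange₂ : ∀ L c n h₂ → L * c + n * c + (1 + h₂) * c ≡ (L + (1 + h₂)) * c + n * c
          rearrange₂ = solveℕ-∀
          ≢a[L+h₁]+aₙ : ∀ m → L < m → m ≤ L + h → a m +ℤ a K ≢ a (L + (1 + h₂)) +ℤ a n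
          ≢a[L+h₁]+aₙ m _ m≤n eq = c∤u (∣m+n∣m⇒∣n (subst (c ∣_) total≡ (n∣m*n (l + n))) (n∣m*n (m + n)))
            where
            l = L + (1 + h₂)
            sums≡ : m * c + (n * c + u) ≡ l * c + n * c
            sums≡ = equal-sums (a-closed m m≤n) a-last a[L+h₁] (a-closed n ℕP.≤-refl) eq
            distrib : ∀ l n c → (l + n) * c ≡ l * c + n * c
            distrib = solveℕ-∀
            regroup : ∀ m n c u → m * c + (n * c + u) ≡ (m + n) * c + u
            regroup = solveℕ-∀
            total≡ : (l + n) * c ≡ (m + n) * c + u
            total≡ = ≡.trans (distrib l n c) (≡.trans (sym sums≡) (regroup m n c u))

      c∣u⇒c≡1 : c ∣ u → c ≡ 1
      c∣u⇒c≡1 c∣u = coprime c c∣a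
        where
        c∣a : ∀ i → i ≤ K → c ∣ ℤ.∣ a i ∣
        c∣a i i≤K with ℕP.m≤n⇒m<n∨m≡n i≤K
        ... | inj₁ i<K    = subst (λ x → c ∣ ℤ.∣ x ∣) (sym (a-closed i (ℕP.≤-pred i<K))) (n∣m*n i)
        ... | inj₂ ≡.refl = subst (λ x → c ∣ ℤ.∣ x ∣) (sym a-last) (∣m∣n⇒∣m+n (n∣m*n n) c∣u)

      a-unit : c ≡ 1 → ∀ j → j ≤ n → a j ≡ + j
      a-unit c≡1 j j≤ = ≡.trans (a-closed j j≤) (cong +_ (≡.trans (cong (j *_) c≡1) (ℕP.*-identityʳ j)))

      a-last-unit : c ≡ 1 → a K ≡ + (n + u)
      a-last-unit c≡1 = ≡.trans a-last (cong (λ x → + (x + u)) (≡.trans (cong (n *_) c≡1) (ℕP.*-identityʳ n)))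

      gap-before-last : GapBeforeLast
      gap-before-last with step-cases c≤u c∣u⇒c≡1
      ... | inj₁ 2c<u                      = ⊥-elim (not-above-2c 2c<u)
      ... | inj₂ (inj₁ (c<u , u<2c , c∤u)) = ⊥-elim (c∤u (between⇒c∣u c<u u<2c))
      ... | inj₂ (inj₂ (c≡1 , inj₁ u≡1))   = ⊥-elim (not-progression a≡i)
        where
        a≡i : ∀ i → i ≤ K → a i ≡ + i
        a≡i i i≤K with ℕP.m≤n⇒m<n∨m≡n i≤K
        ... | inj₁ i<K    = a-unit c≡1 i (ℕP.≤-pred i<K)
        ... | inj₂ ≡.refl = ≡.trans (a-last-unit c≡1) (cong +_ (≡.trans (cong (λ x → n + x) u≡1) (ℕP.+-comm n 1)))
      ... | inj₂ (inj₂ (c≡1 , inj₂ u≡2))   =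
        (λ i i<K → a-unit c≡1 i (ℕP.≤-pred i<K)) ,
        ≡.trans (a-last-unit c≡1) (cong +_ (≡.trans (cong (λ x → n + x) u≡2) (ℕP.+-comm n 2)))

    missing-element : GapAfterFirst ⊎ GapBeforeLast
    missing-element = Sum.map LargeFirst.gap-after-first LargeLast.gap-before-last step-structure

module Enumeration (A : List ℤ) (A-unique : Unique A) where

  sorted : List ℤ
  sorted = Sort.sort A

  sorted↭A : sorted ↭ A
  sorted↭A = Sort.sort-↭ A

  |sorted| : length sorted ≡ length A
  |sorted| = ↭-length sorted↭A

  a : ℕ → ℤ
  a = nth sorted

  a-inc : ∀ i → suc i < length A → a i <ℤ a (suc i)
  a-inc i i+1< = nth-strict (Sort.sort-↗ A) (Unique-resp-↭ (↭-sym sorted↭A) A-unique) i (subst (suc i <_) (sym |sorted|) i+1<)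

  a-∈ : ∀ {i} → i < length A → a i ∈ A
  a-∈ {i} i< = ∈-resp-↭ sorted↭A (nth-∈ sorted (subst (i <_) (sym |sorted|) i<))

  ∈⇒a : ∀ {z} → z ∈ A → ∃ λ i → i < length A × a i ≡ z
  ∈⇒a z∈ with ∈⇒nth (∈-resp-↭ (↭-sym sorted↭A) z∈)
  ... | i , i< , eq = i , subst (i <_) |sorted| i< , eq

  a₀≡0 : + 0 ∈ A → (∀ z → z ∈ A → + 0 ≤ℤ z) → a 0 ≡ + 0
  a₀≡0 0∈A A≥0 with ∈⇒a 0∈A
  ... | i , i< , aᵢ≡0 = ℤP.≤-antisym (subst (a 0 ≤ℤ_) aᵢ≡0 (nth-mono-≤ (Sort.sort-↗ A) z≤n (subst (i <_) (sym |sorted|) i<)))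
                                     (A≥0 (a 0) (a-∈ (ℕP.≤-<-trans z≤n i<)))

  coprime : gcdSet A ≡ 1 → ∀ g → (∀ i → i < length A → g ∣ ℤ.∣ a i ∣) → g ≡ 1
  coprime gcd≡1 g g∣a = ∣1⇒≡1 (subst (g ∣_) gcd≡1 (g∣gcdSet A (λ z∈ → g∣∈A z∈)))
    where
    g∣∈A : ∀ {z} → z ∈ A → g ∣ ℤ.∣ z ∣
    g∣∈A z∈ with ∈⇒a z∈
    ... | i , i< , ≡.refl = g∣a i i<
    g∣gcdSet : ∀ xs → (∀ {z} → z ∈ xs → g ∣ ℤ.∣ z ∣) → g ∣ gcdSet xs
    g∣gcdSet []       _   = divides 0 ≡.refl
    g∣gcdSet (x ∷ xs) g∣· = gcd-greatest (g∣· (here ≡.refl)) (g∣gcdSet xs (λ z∈ → g∣· (there z∈)))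

  omit-one-∈ : ∀ h {t p} → t ≤ p → p ≤ t + h → t + suc h ≤ length A →
               InRestrictedSumset h A (sumRange a t (suc h) -ℤ a p)
  omit-one-∈ h t≤p p≤ len = InRestrictedSumset-resp-↭ sorted↭A
    (InRestrictedSumset-omit-one sorted h t≤p p≤ (subst (_ ≤_) (sym |sorted|) len))

  omit-two-∈ : ∀ h {t p q} → t ≤ p → p < q → q ≤ t + suc h → t + suc (suc h) ≤ length A →
               InRestrictedSumset h A (sumRange a t (suc (suc h)) -ℤ a p -ℤ a q)
  omit-two-∈ h t≤p p<q q≤ len = InRestrictedSumset-resp-↭ sorted↭A
    (InRestrictedSumset-omit-two sorted h t≤p p<q q≤ (subst (_ ≤_) (sym |sorted|) len))

  sum-bounds : ∀ {h s} → InRestrictedSumset h A s → sumRange a 0 h ≤ℤ s × s ≤ℤ sumRange a (length A ∸ h) h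
  sum-bounds {h} s∈ with InRestrictedSumset-resp-↭ (↭-sym sorted↭A) s∈
  ... | bs , bs⊆ , ≡.refl , ≡.refl =
    sum-⊆-lower bs⊆ (Sort.sort-↗ A) ,
    subst (λ l → _ ≤ℤ sumRange a (l ∸ length bs) (length bs)) |sorted| (sum-⊆-upper bs⊆ (Sort.sort-↗ A))

  IntervalWithout : ℕ → ℕ → Set
  IntervalWithout k x = ∀ z → (z ∈ A) ⇔ ((+ 0 ≤ℤ z) × (z ≤ℤ + k) × ¬ (z ≡ + x))

  interval-without-1 : ∀ {N} → length A ≡ suc N → a 0 ≡ + 0 → (∀ i → 1 ≤ i → i ≤ N → a i ≡ + suc i) →
                       IntervalWithout (suc N) 1
  interval-without-1 {N} |A| a₀≡0 a≡ z = mk⇔ (to z) (from z)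
    where
    to : ∀ z → z ∈ A → (+ 0 ≤ℤ z) × (z ≤ℤ + suc N) × ¬ (z ≡ + 1)
    to z z∈ with ∈⇒a z∈
    ... | zero  , _  , ≡.refl = subst (λ y → (+ 0 ≤ℤ y) × (y ≤ℤ + suc N) × ¬ (y ≡ + 1))
                                  (sym a₀≡0) (ℤ.+≤+ z≤n , ℤ.+≤+ z≤n , λ ())
    ... | suc j , j< , ≡.refl = subst (λ y → (+ 0 ≤ℤ y) × (y ≤ℤ + suc N) × ¬ (y ≡ + 1))
                                  (sym (a≡ (suc j) (s≤s z≤n) j≤N))
                                      (ℤ.+≤+ z≤n , ℤ.+≤+ (s≤s j≤N) , λ ())
      where j≤N = ℕP.≤-pred (subst (suc j <_) |A| j<)
    from : ∀ z → (+ 0 ≤ℤ z) × (z ≤ℤ + suc N) × ¬ (z ≡ + 1) → z ∈ A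
    from (+ zero)          _                     = subst (_∈ A) a₀≡0 (a-∈ (subst (0 <_) (sym |A|) (s≤s z≤n)))
    from (+ suc zero)      (_ , _ , z≢1)         = ⊥-elim (z≢1 ≡.refl)
    from (+ suc (suc j))   (_ , ℤ.+≤+ z≤ , _)    = subst (_∈ A) (a≡ (suc j) (s≤s z≤n) (ℕP.≤-pred z≤))
                                                   (a-∈ (subst (suc j <_) (sym |A|) z≤))

  interval-without-last : ∀ {N} → length A ≡ suc N → (∀ i → i < N → a i ≡ + i) → a N ≡ + suc N →
                          IntervalWithout (suc N) N
  interval-without-last {N} |A| a≡ a[N]≡ z = mk⇔ (to z) (from z)
    where
    to : ∀ z → z ∈ A → (+ 0 ≤ℤ z) × (z ≤ℤ + suc N) × ¬ (z ≡ + N)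
    to z z∈ with ∈⇒a z∈
    ... | i , i< , ≡.refl with ℕP.m≤n⇒m<n∨m≡n (ℕP.≤-pred (subst (suc i ≤_) |A| i<))
    ...   | inj₁ i<N    = subst (λ y → (+ 0 ≤ℤ y) × (y ≤ℤ + suc N) × ¬ (y ≡ + N)) (sym (a≡ i i<N))
                                (ℤ.+≤+ z≤n , ℤ.+≤+ (ℕP.m≤n⇒m≤1+n (ℕP.<⇒≤ i<N)) , λ i≡N → ℕP.<⇒≢ i<N (ℤP.+-injective i≡N))
    ...   | inj₂ ≡.refl = subst (λ y → (+ 0 ≤ℤ y) × (y ≤ℤ + suc N) × ¬ (y ≡ + N)) (sym a[N]≡)
                                (ℤ.+≤+ z≤n , ℤP.≤-refl , λ N+1≡N → ℕP.1+n≢n (ℤP.+-injective N+1≡N))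
    from : ∀ z → (+ 0 ≤ℤ z) × (z ≤ℤ + suc N) × ¬ (z ≡ + N) → z ∈ A
    from (+ j) (_ , ℤ.+≤+ j≤N+1 , j≢N) with ℕP.<-cmp j N
    ... | tri< j<N _ _   = subst (_∈ A) (a≡ j j<N) (a-∈ (subst (j <_) (sym |A|) (ℕP.m<n⇒m<1+n j<N)))
    ... | tri≈ _ ≡.refl _ = ⊥-elim (j≢N ≡.refl)
    ... | tri> _ _ N<j   = subst (_∈ A) (≡.trans a[N]≡ (cong +_ (ℕP.≤-antisym N<j j≤N+1)))
                             (a-∈ (subst (N <_) (sym |A|) ℕP.≤-refl))

length-decomposition : ∀ h k → 3 ≤ h → 3 * h + 1 ≤ k → ∃ λ L → k ≡ 2 + (L + h) × h + h ≤ suc L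
length-decomposition h k 3≤h 3h+1≤k = L , sym k≡ ,
  ℕP.+-cancelʳ-≤ (suc h) (h + h) (suc L) (subst₂ _≤_ (3h+1≡ h) (≡.trans (sym k≡) (k≡′ L h)) 3h+1≤k)
  where
  3h+1≡ : ∀ h → 3 * h + 1 ≡ h + h + suc h
  3h+1≡ = solveℕ-∀
  k≡′ : ∀ L h → 2 + (L + h) ≡ suc L + suc h
  k≡′ = solveℕ-∀
  2+h≤k : 2 + h ≤ k
  2+h≤k = ℕP.≤-trans (ℕP.≤-trans (ℕP.+-monoˡ-≤ h (ℕP.≤-trans (s≤s (s≤s z≤n)) 3≤h)) (ℕP.m≤m+n (h + h) (suc h)))
                     (subst (_≤ k) (3h+1≡ h) 3h+1≤k)
  L = k ∸ (2 + h)
  k≡ : 2 + (L + h) ≡ k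
  k≡ = ≡.trans (rearrange L h) (ℕP.m∸n+n≡m 2+h≤k)
    where
    rearrange : ∀ L h → 2 + (L + h) ≡ L + (2 + h)
    rearrange = solveℕ-∀

sumset-size : ∀ h L → (h * (2 + (L + h)) + 2) ∸ (h * h) ≡ 2 + (2 + L) * h
sumset-size h L = ≡.trans (cong (_∸ (h * h)) (rearrange h L)) (ℕP.m+n∸m≡n (h * h) _)
  where
  rearrange : ∀ h L → h * (2 + (L + h)) + 2 ≡ h * h + (2 + (2 + L) * h)
  rearrange = solveℕ-∀

theorem1p10 : (h k : ℕ) → 3 ≤ h → 3 * h + 1 ≤ k →
    (A : List ℤ) → Unique A → length A ≡ k →
    (+ 0) ∈ A → (∀ a → a ∈ A → + 0 ≤ℤ a) →
    gcdSet A ≡ 1 →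
    RestrictedSumsetCard h A ((h * k + 2) ∸ (h * h)) →
    ∃[ x ] ((x ≡ 1 ⊎ x ≡ k ∸ 1) ×
      (∀ z → (z ∈ A) ⇔ ((+ 0 ≤ℤ z) × (z ≤ℤ + k) × ¬ (z ≡ + x))))
theorem1p10 h k 3≤h 3h+1≤k A A-unique |A| 0∈A A≥0 gcd≡1 (S , S-unique , |S| , S≡h^A)
  with length-decomposition h k 3≤h 3h+1≤k
... | L , ≡.refl , 2h≤L+1 =
  [ (λ gap → 1 , inj₁ ≡.refl , interval-without-1 |A| (a₀≡0 0∈A A≥0) gap) ,
    (λ (below , last) → suc (L + h) , inj₂ ≡.refl , interval-without-last |A| below last) ]′ missing-element
  where
  open Enumeration A A-unique
  within : ∀ {j} → j ≤ suc (L + h) → j < length A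
  within j≤ = subst (_ <_) (sym |A|) (s≤s j≤)
  omit-∈ : ∀ t m → t ≤ suc L → t ≤ m → m ≤ t + h → sumRange a t (suc h) -ℤ a m ∈ S
  omit-∈ t m t≤ t≤m m≤ = Equivalence.from (S≡h^A _)
    (omit-one-∈ h t≤m m≤ (subst (_≤ length A) (sym (ℕP.+-suc t h)) (within (ℕP.+-monoˡ-≤ h t≤))))
  omit₂-∈ : ∀ i p q → i ≤ L → i ≤ p → p < q → q ≤ i + suc h → sumRange a i (suc (suc h)) -ℤ a p -ℤ a q ∈ S
  omit₂-∈ i p q i≤L i≤p p<q q≤ = Equivalence.from (S≡h^A _)
    (omit-two-∈ h i≤p p<q q≤ (subst (_≤ length A) (sym (≡.trans (ℕP.+-suc i (suc h)) (cong suc (ℕP.+-suc i h))))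
                                    (within (s≤s (ℕP.+-monoˡ-≤ h i≤L)))))
  bounded : ∀ {s} → s ∈ S → sumRange a 0 h ≤ℤ s × s ≤ℤ sumRange a (2 + L) h
  bounded {s} s∈ = subst (λ l → sumRange a 0 h ≤ℤ s × s ≤ℤ sumRange a l h)
                         (≡.trans (cong (_∸ h) |A|) (ℕP.m+n∸n≡m (2 + L) h))
                         (sum-bounds (Equivalence.to (S≡h^A _) s∈))
  increasing : ∀ i → i ≤ L + h → a i <ℤ a (suc i)
  increasing i i≤ = a-inc i (within (s≤s i≤))
  coprime′ : ∀ g → (∀ i → i ≤ suc (L + h) → g ∣ ℤ.∣ a i ∣) → g ≡ 1
  coprime′ g g∣a = coprime gcd≡1 g (λ i i< → g∣a i (ℕP.≤-pred (subst (i <_) |A| i<)))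
  open OneExtraSum h L 3≤h 2h≤L+1 a increasing S S-unique (≡.trans |S| (sumset-size h L)) omit-∈ omit₂-∈
  open Normalised (a₀≡0 0∈A A≥0) coprime′ bounded
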